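{- With the notation in the context, the following three sets are in natural one-to-one correspondence: (i) sections $s_\alpha:\mathrm{SL}_2(\mathbb{Z}/n\mathbb{Z})\to N_n$ of $\alpha$ (group homomorphisms with $\alpha\circ s_\alpha=\mathrm{id}$) that are compatible with $s_\beta$, i.e. $s_\alpha(\gamma)\,\theta(h)\,s_\alpha(\gamma)^{ -1}=\theta(s_\beta(\gamma)h)$ for all $h\in H_n$, $\gamma\in\mathrm{SL}_2(\mathbb{Z}/n\mathbb{Z})$; (ii) lifts of the projective representation $\overline{\rho}:\mathrm{SL}_2(\mathbb{Z}/n\mathbb{Z})\to\mathrm{PGL}_n(K)$ to representations $\rho:\mathrm{SL}_2(\mathbb{Z}/n\mathbb{Z})\to\mathrm{SL}_n(K)$; (iii) extensions of $\theta:H_n\to\mathrm{SL}_n(K)$ to representations $\theta^+:H_n^+\to\mathrm{SL}_n(K)$ (i.e. $\theta^+(h,1)=\theta(h)$ for all $h\in H_n$).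
   Context: Let $n\ge5$ be an odd integer, $K$ an algebraically closed field of characteristic not dividing $n$, and $\zeta_n\in K$ a primitive $n$th root of unity. The Heisenberg group is $H_n=\langle\sigma,\tau\mid\sigma^n=\tau^n=[\sigma,[\sigma,\tau]]=[\tau,[\sigma,\tau]]=1\rangle$, of order $n^3$, with centre generated by $\zeta=[\sigma,\tau]=\sigma\tau\sigma^{ -1}\tau^{ -1}$; the quotient $\overline{H}_n$ by the centre is identified with $(\mathbb{Z}/n\mathbb{Z})^2$ via $\overline\sigma\mapsto(1,0)$, $\overline\tau\mapsto(0,1)$. Let $s_\beta:\mathrm{GL}_2(\mathbb{Z}/n\mathbb{Z})\to\mathrm{Aut}(H_n)$ be the homomorphism given by $s_\beta\begin{pmatrix}a&b\\c&d\end{pmatrix}:\ \sigma\mapsto\zeta^{ -ac/2}\sigma^a\tau^c,\ \tau\mapsto\zeta^{ -bd/2}\sigma^b\tau^d$ (here $1/2$ denotes the inverse of $2$ mod $n$). The extended Heisenberg group is the semidirect product $H_n^+=H_n\ltimes\mathrm{SL}_2(\mathbb{Z}/n\mathbb{Z})$ with group law $(h,\gamma)(h',\gamma')=(h\,s_\beta(\gamma)h',\gamma\gamma')$. The Schrödinger representation $\theta:H_n\to\mathrm{SL}_n(K)$ acts on $K^n$ with basis $e_0,\dots,e_{n-1}$ (indices mod $n$) by $\theta(\sigma)e_i=\zeta_n^ie_i$, $\theta(\tau)e_i=e_{i+1}$; so $\theta(\zeta)=\zeta_nI_n$. Let $N_n$ be the normaliser of $\theta(H_n)$ in $\mathrm{SL}_n(K)$;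 conjugation by $g\in N_n$ induces an automorphism of $\overline{H}_n\cong(\mathbb{Z}/n\mathbb{Z})^2$ preserving the commutator pairing, which defines a (surjective) homomorphism $\alpha:N_n\to\mathrm{SL}_2(\mathbb{Z}/n\mathbb{Z})$. The projective representation $\overline\rho:\mathrm{SL}_2(\mathbb{Z}/n\mathbb{Z})\to\mathrm{PGL}_n(K)$ is defined by requiring $\overline\rho(\gamma)\,\theta(h)\,\overline\rho(\gamma)^{ -1}=\theta(s_\beta(\gamma)h)$ for all $h\in H_n$, $\gamma\in\mathrm{SL}_2(\mathbb{Z}/n\mathbb{Z})$. -}

module Defs where

open import Level using (_⊔_)
open import Algebra.Bundles using (CommutativeRing)
open import Data.Nat as ℕ using (ℕ; zero; suc; NonZero; _≤_; _<_)
open import Data.Nat.DivMod using (_mod_)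
open import Data.Fin as Fin using (Fin; toℕ; punchIn)
open import Data.List using (List; []; _∷_; _++_; [_]; length)
open import Data.Product using (Σ; ∃; _×_; _,_)
open import Data.Bool using (if_then_else_)
open import Relation.Nullary using (¬_)
open import Relation.Nullary.Decidable using (⌊_⌋)
open import Relation.Binary.PropositionalEquality using (_≡_)

module _ {c ℓ} (K : CommutativeRing c ℓ) where
  open CommutativeRing K

  IsField : Set (c ⊔ ℓ)
  IsField = (¬ (1# ≈ 0#)) × (∀ x → ¬ (x ≈ 0#) → ∃ λ y → (x * y) ≈ 1#)

  evalPoly : List Carrier → Carrier → Carrier
  evalPoly []       x = 0#
  evalPoly (a ∷ as) x = a + (x * evalPoly as x)

  AlgClosed : Set (c ⊔ ℓ)
  AlgClosed = (cs : List Carrier) (lead : Carrier) → ¬ (lead ≈ 0#) →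
              1 ≤ length cs → ∃ λ x → evalPoly (cs ++ [ lead ]) x ≈ 0#

  natK : ℕ → Carrier
  natK zero    = 0#
  natK (suc m) = 1# + natK m

  CharNotDividing : ℕ → Set ℓ
  CharNotDividing n = ¬ (natK n ≈ 0#)

  powK : Carrier → ℕ → Carrier
  powK x zero    = 1#
  powK x (suc m) = x * powK x m

  PrimitiveRoot : ℕ → Carrier → Set ℓ
  PrimitiveRoot n z = (powK z n ≈ 1#) × (∀ k → 1 ≤ k → k < n → ¬ (powK z k ≈ 1#))

module ZMod (n : ℕ) {{_ : NonZero n}} where
  Zn : Set
  Zn = Fin n

  _+ₙ_ : Zn → Zn → Zn
  a +ₙ b = (toℕ a ℕ.+ toℕ b) mod n

  _*ₙ_ : Zn → Zn → Zn
  a *ₙ b = (toℕ a ℕ.* toℕ b) mod n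

  -ₙ_ : Zn → Zn
  -ₙ a = (n ℕ.∸ toℕ a) mod n

  0ₙ 1ₙ : Zn
  0ₙ = 0 mod n
  1ₙ = 1 mod n

  -- the inverse of 2 mod n (n odd): (n+1)/2
  half : Zn
  half = (suc n ℕ./ 2) mod n

  record M2 : Set where
    constructor m2
    field m11 m12 m21 m22 : Zn

  _·₂_ : M2 → M2 → M2
  m2 a b c d ·₂ m2 a' b' c' d' =
    m2 ((a *ₙ a') +ₙ (b *ₙ c')) ((a *ₙ b') +ₙ (b *ₙ d'))
       ((c *ₙ a') +ₙ (d *ₙ c')) ((c *ₙ b') +ₙ (d *ₙ d'))

  I₂ : M2
  I₂ = m2 1ₙ 0ₙ 0ₙ 1ₙ

  IsSL : M2 → Set
  IsSL (m2 a b c d) = (a *ₙ d) ≡ (1ₙ +ₙ (b *ₙ c))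

  -- The Heisenberg group H_n, as normal forms ζ^z σ^x τ^y.
  -- Using τσ = ζ⁻¹στ (from ζ = στσ⁻¹τ⁻¹):
  -- (ζ^z σ^x τ^y)(ζ^z' σ^x' τ^y') = ζ^(z+z'-x'y) σ^(x+x') τ^(y+y').
  record H : Set where
    constructor hei
    field
      zc : Zn
      xs : Zn
      yt : Zn
  open H public

  _·H_ : H → H → H
  hei z x y ·H hei z' x' y' = hei ((z +ₙ z') +ₙ (-ₙ (x' *ₙ y))) (x +ₙ x') (y +ₙ y')

  eH σH τH ζH : H
  eH = hei 0ₙ 0ₙ 0ₙ
  σH = hei 0ₙ 1ₙ 0ₙ
  τH = hei 0ₙ 0ₙ 1ₙ
  ζH = hei 1ₙ 0ₙ 0ₙ

  powH : H → ℕ → H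
  powH h zero    = eH
  powH h (suc m) = h ·H powH h m

  -- s_β(γ) : σ ↦ ζ^(-ac/2) σ^a τ^c , τ ↦ ζ^(-bd/2) σ^b τ^d,
  -- extended to H as a homomorphism: ζ^z σ^x τ^y ↦ ζ^z s(σ)^x s(τ)^y
  sβ : M2 → H → H
  sβ (m2 a b c d) (hei z x y) =
    powH ζH (toℕ z) ·H (powH (hei (-ₙ ((a *ₙ c) *ₙ half)) a c) (toℕ x)
                   ·H powH (hei (-ₙ ((b *ₙ d) *ₙ half)) b d) (toℕ y))

  -- the extended Heisenberg group H_n⁺ = H_n ⋊ SL₂(ℤ/nℤ)
  _·H⁺_ : H × M2 → H × M2 → H × M2
  (h , γ) ·H⁺ (h' , γ') = (h ·H sβ γ h') , (γ ·₂ γ')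

module Setup {c ℓ} (K : CommutativeRing c ℓ) (n : ℕ) {{nz : NonZero n}} (ζn : CommutativeRing.Carrier K) where
  open CommutativeRing K
  open ZMod n public

  Mat : ℕ → Set c
  Mat m = Fin m → Fin m → Carrier

  sumF : ∀ {m} → (Fin m → Carrier) → Carrier
  sumF {zero}  f = 0#
  sumF {suc m} f = f Fin.zero + sumF (λ i → f (Fin.suc i))

  _⊗_ : ∀ {m} → Mat m → Mat m → Mat m
  (A ⊗ B) i j = sumF (λ k → A i k * B k j)

  idM : ∀ {m} → Mat m
  idM i j = if ⌊ i Fin.≟ j ⌋ then 1# else 0#

  _·s_ : ∀ {m} → Carrier → Mat m → Mat m
  (x ·s A) i j = x * A i j

  powM : ∀ {m} → Mat m → ℕ → Mat m
  powM A zero    = idM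
  powM A (suc k) = A ⊗ powM A k

  sgn : ℕ → Carrier
  sgn zero    = 1#
  sgn (suc k) = - sgn k

  det : ∀ {m} → Mat m → Carrier
  det {zero}  A = 1#
  det {suc m} A = sumF (λ j → (sgn (toℕ j) * A Fin.zero j) *
                              det (λ i k → A (Fin.suc i) (punchIn j k)))

  _≈M_ : Mat n → Mat n → Set ℓ
  A ≈M B = ∀ i j → A i j ≈ B i j

  -- Schrödinger representation: θ(σ) e_i = ζn^i e_i , θ(τ) e_i = e_{i+1}
  -- (column i of a matrix = image of e_i)
  θσ θτ : Mat n
  θσ r i = if ⌊ r Fin.≟ i ⌋ then powK K ζn (toℕ i) else 0#
  θτ r i = if ⌊ r Fin.≟ (i +ₙ 1ₙ) ⌋ then 1# else 0#

  θ : H → Mat n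
  θ (hei z x y) = powK K ζn (toℕ z) ·s (powM θσ (toℕ x) ⊗ powM θτ (toℕ y))

  -- g lies in N_n, the normaliser of θ(H_n) in SL_n(K)
  InN : Mat n → Set ℓ
  InN g = (det g ≈ 1#)
        × (∀ h → ∃ λ h' → (g ⊗ θ h) ≈M (θ h' ⊗ g))
        × (∀ h' → ∃ λ h → (g ⊗ θ h) ≈M (θ h' ⊗ g))

  -- α(g) = γ : conjugation by g induces γ on H̄_n ≅ (ℤ/nℤ)²,
  -- i.e. g θ(σ) g⁻¹ ≡ θ(σ^a τ^c) and g θ(τ) g⁻¹ ≡ θ(σ^b τ^d) mod centre
  AlphaIs : Mat n → M2 → Set ℓ
  AlphaIs g (m2 a b c d) =
      (∃ λ z → (g ⊗ θ σH) ≈M (θ (hei z a c) ⊗ g))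
    × (∃ λ z → (g ⊗ θ τH) ≈M (θ (hei z b d) ⊗ g))

  -- Functions out of SL₂(ℤ/nℤ) are represented as functions on all 2×2
  -- matrices, constrained (and compared) only on elements of SL₂.

  record SecI : Set (c ⊔ ℓ) where
    field
      fun    : M2 → Mat n
      inN    : ∀ γ → IsSL γ → InN (fun γ)
      hom    : ∀ γ γ' → IsSL γ → IsSL γ' → fun (γ ·₂ γ') ≈M (fun γ ⊗ fun γ')
      sect   : ∀ γ → IsSL γ → AlphaIs (fun γ) γ
      compat : ∀ γ → IsSL γ → ∀ h → (fun γ ⊗ θ h) ≈M (θ (sβ γ h) ⊗ fun γ)

  -- (ii) lifts ρ : SL₂(ℤ/nℤ) → SL_n(K) of ρ̄ : the class of ρ(γ) in PGL_n(K)
  -- satisfies the defining property of ρ̄(γ)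
  record LiftII : Set (c ⊔ ℓ) where
    field
      fun  : M2 → Mat n
      detl : ∀ γ → IsSL γ → det (fun γ) ≈ 1#
      hom  : ∀ γ γ' → IsSL γ → IsSL γ' → fun (γ ·₂ γ') ≈M (fun γ ⊗ fun γ')
      lift : ∀ γ → IsSL γ → ∀ h → (fun γ ⊗ θ h) ≈M (θ (sβ γ h) ⊗ fun γ)

  record ExtIII : Set (c ⊔ ℓ) where
    field
      fun  : H × M2 → Mat n
      detl : ∀ h γ → IsSL γ → det (fun (h , γ)) ≈ 1#
      hom  : ∀ h γ h' γ' → IsSL γ → IsSL γ' →
             fun ((h , γ) ·H⁺ (h' , γ')) ≈M (fun (h , γ) ⊗ fun (h' , γ'))
      ext  : ∀ h → fun (h , I₂) ≈M θ h

  _≈I_ : SecI → SecI → Set ℓ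
  s ≈I s' = ∀ γ → IsSL γ → SecI.fun s γ ≈M SecI.fun s' γ

  _≈II_ : LiftII → LiftII → Set ℓ
  ρ ≈II ρ' = ∀ γ → IsSL γ → LiftII.fun ρ γ ≈M LiftII.fun ρ' γ

  _≈III_ : ExtIII → ExtIII → Set ℓ
  t ≈III t' = ∀ h γ → IsSL γ → ExtIII.fun t (h , γ) ≈M ExtIII.fun t' (h , γ)

  record Correspondence : Set (c ⊔ ℓ) where
    field
      toII      : SecI → LiftII
      toII-def  : ∀ s γ → IsSL γ → LiftII.fun (toII s) γ ≈M SecI.fun s γ
      toIII     : LiftII → ExtIII
      toIII-def : ∀ ρ h γ → IsSL γ →
                  ExtIII.fun (toIII ρ) (h , γ) ≈M (θ h ⊗ LiftII.fun ρ γ)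
      toI       : ExtIII → SecI
      toI-def   : ∀ t γ → IsSL γ → SecI.fun (toI t) γ ≈M ExtIII.fun t (eH , γ)
      cycleI    : ∀ s → toI (toIII (toII s)) ≈I s
      cycleII   : ∀ ρ → toII (toI (toIII ρ)) ≈II ρ
      cycleIII  : ∀ t → toIII (toII (toI t)) ≈III t

module Submission where

-- Apart from the group laws of H_n⁺, two facts about θ are needed.
-- (1) det(θ(h) A) = det A: θ(h) rescales the rows of A by factors ζ^(z+xr)
--     whose product over r ∈ ℤ/nℤ is 1 and shifts them cyclically, an even
--     permutation as n is odd (proved by Laplace expansion along the last row).
-- (2) ρ(1) = 1 for a lift ρ: ρ(1) commutes with θ(σ) and θ(τ), so it is a
--     scalar λ (the ζ^i being distinct), and λ² = λ, λⁿ = det ρ(1) = 1 give λ = 1.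
-- The file develops determinants over a commutative ring, the ring ℤ/nℤ with
-- a ring solver, the Schrödinger representation, identities in H_n and
-- SL₂(ℤ/nℤ), and finally the three maps.

open import Defs
open import Algebra.Bundles using (CommutativeRing)
open import Data.Nat using (ℕ; NonZero; _≤_; _%_)
open import Relation.Binary.PropositionalEquality using (_≡_)

import Data.Nat as ℕ
open import Data.Nat using (zero; suc; s≤s; z≤n)
import Data.Nat.Properties as NP
import Data.Nat.DivMod
open import Data.Nat.Solver using (module +-*-Solver)
import Data.Integer as ℤ
open import Data.Integer using (ℤ; +_; -[1+_]; _⊖_; _◃_)
import Data.Integer.Properties as ℤP
open import Data.Sign as Sign using (Sign)
open import Data.Fin as Fin using (Fin; zero; suc; toℕ; punchIn; punchOut; fromℕ; inject₁)
import Data.Fin.Properties as FP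
open import Data.Product using (∃; _,_; proj₁; proj₂)
open import Data.Bool using (if_then_else_)
open import Data.Maybe using (Maybe; just; nothing)
open import Data.Empty using (⊥-elim)
open import Function using (_∘_)
open import Relation.Nullary using (¬_; Dec; yes; no)
open import Relation.Nullary.Decidable using (⌊_⌋)
open import Relation.Binary.Definitions using (tri<; tri≈; tri>)
open import Relation.Binary.Bundles using (Setoid)
import Relation.Binary.PropositionalEquality as ≡
import Relation.Binary.Reasoning.Setoid
import Algebra.Solver.CommutativeMonoid
open import Algebra.Solver.Ring.AlmostCommutativeRing using (fromCommutativeRing; _-Raw-AlmostCommutative⟶_)

-- The canonical map ℤ → R into any commutative ring is a ring
-- homomorphism; this lets the ring solver use integer coefficients, whose
-- arithmetic computes even when that of R does not (as in ℤ/nℤ for a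
-- variable n).
module IntegerCoefficients {c ℓ} (R : CommutativeRing c ℓ) where
  open CommutativeRing R hiding (zero)
  open import Relation.Binary.Reasoning.Setoid setoid
  open import Algebra.Properties.Ring ring using (-‿distribˡ-*; -‿involutive; -0#≈0#; -‿+-comm)
  module *S = Algebra.Solver.CommutativeMonoid *-commutativeMonoid
  module +S = Algebra.Solver.CommutativeMonoid +-commutativeMonoid

  ⟦_⟧ℤ : ℤ → Carrier
  ⟦ + m ⟧ℤ = natK R m
  ⟦ -[1+ m ] ⟧ℤ = - natK R (suc m)

  natK-+ : ∀ m k → natK R (m ℕ.+ k) ≈ natK R m + natK R k
  natK-+ zero k = sym (+-identityˡ _)
  natK-+ (suc m) k = trans (+-congˡ (natK-+ m k)) (sym (+-assoc _ _ _))

  natK-* : ∀ m k → natK R (m ℕ.* k) ≈ natK R m * natK R k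
  natK-* zero k = sym (zeroˡ _)
  natK-* (suc m) k = begin
      natK R (k ℕ.+ m ℕ.* k)            ≈⟨ natK-+ k (m ℕ.* k) ⟩
      natK R k + natK R (m ℕ.* k)       ≈⟨ +-congˡ (natK-* m k) ⟩
      natK R k + natK R m * natK R k    ≈⟨ +-congʳ (sym (*-identityˡ _)) ⟩
      1# * natK R k + natK R m * natK R k ≈⟨ sym (distribʳ _ _ _) ⟩
      (1# + natK R m) * natK R k ∎

  ⊖-hom : ∀ m k → ⟦ m ⊖ k ⟧ℤ ≈ natK R m - natK R k
  ⊖-hom zero zero = sym (trans (+-congˡ -0#≈0#) (+-identityʳ _))
  ⊖-hom (suc m) zero = sym (trans (+-congˡ -0#≈0#) (+-identityʳ _))
  ⊖-hom zero (suc k) = sym (+-identityˡ _)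
  ⊖-hom (suc m) (suc k) = begin
      ⟦ suc m ⊖ suc k ⟧ℤ              ≡⟨ ≡.cong ⟦_⟧ℤ (ℤP.[1+m]⊖[1+n]≡m⊖n m k) ⟩
      ⟦ m ⊖ k ⟧ℤ                      ≈⟨ ⊖-hom m k ⟩
      natK R m - natK R k             ≈⟨ sym (+-identityˡ _) ⟩
      0# + (natK R m - natK R k)      ≈⟨ +-congʳ (sym (-‿inverseʳ 1#)) ⟩
      (1# - 1#) + (natK R m - natK R k) ≈⟨ regroup 1# (natK R m) (- 1#) (- natK R k) ⟩
      (1# + natK R m) + (- 1# - natK R k) ≈⟨ +-congˡ (-‿+-comm 1# (natK R k)) ⟩
      (1# + natK R m) - (1# + natK R k) ∎
    where
    open +S using (_⊕_; _⊜_)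
    regroup : ∀ a b c d → (a + c) + (b + d) ≈ (a + b) + (c + d)
    regroup = +S.solve 4 (λ a b c d → (a ⊕ c) ⊕ (b ⊕ d) ⊜ (a ⊕ b) ⊕ (c ⊕ d)) refl

  neg-hom : ∀ i → ⟦ ℤ.- i ⟧ℤ ≈ - ⟦ i ⟧ℤ
  neg-hom (+ zero) = sym -0#≈0#
  neg-hom (+ suc m) = refl
  neg-hom -[1+ m ] = sym (-‿involutive _)

  +-hom : ∀ i j → ⟦ i ℤ.+ j ⟧ℤ ≈ ⟦ i ⟧ℤ + ⟦ j ⟧ℤ
  +-hom (+ m) (+ k) = natK-+ m k
  +-hom (+ m) -[1+ k ] = ⊖-hom m (suc k)
  +-hom -[1+ m ] (+ k) = trans (⊖-hom k (suc m)) (+-comm _ _)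
  +-hom -[1+ m ] -[1+ k ] = begin
      - (1# + natK R (suc (m ℕ.+ k)))      ≈⟨ -‿cong (+-congˡ (natK-+ (suc m) k)) ⟩
      - (1# + (natK R (suc m) + natK R k)) ≈⟨ -‿cong (swap-front 1# (natK R (suc m)) (natK R k)) ⟩
      - (natK R (suc m) + (1# + natK R k)) ≈⟨ sym (-‿+-comm _ _) ⟩
      - natK R (suc m) + - (1# + natK R k) ∎
    where
    open +S using (_⊕_; _⊜_)
    swap-front : ∀ a b c → a + (b + c) ≈ b + (a + c)
    swap-front = +S.solve 3 (λ a b c → a ⊕ (b ⊕ c) ⊜ b ⊕ (a ⊕ c)) refl

  -- Integer multiplication is defined through signs and absolute values.
  ⟦_⟧S : Sign → Carrier
  ⟦ Sign.+ ⟧S = 1#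
  ⟦ Sign.- ⟧S = - 1#

  ◃-hom : ∀ s m → ⟦ s ◃ m ⟧ℤ ≈ ⟦ s ⟧S * natK R m
  ◃-hom Sign.+ m = trans (reflexive (≡.cong ⟦_⟧ℤ (ℤP.+◃n≡+n m))) (sym (*-identityˡ _))
  ◃-hom Sign.- m = begin
      ⟦ Sign.- ◃ m ⟧ℤ   ≡⟨ ≡.cong ⟦_⟧ℤ (ℤP.-◃n≡-n m) ⟩
      ⟦ ℤ.- (+ m) ⟧ℤ    ≈⟨ neg-hom (+ m) ⟩
      - natK R m        ≈⟨ -‿cong (sym (*-identityˡ _)) ⟩
      - (1# * natK R m) ≈⟨ -‿distribˡ-* 1# (natK R m) ⟩
      - 1# * natK R m ∎

  sign-hom : ∀ s t → ⟦ s Sign.* t ⟧S ≈ ⟦ s ⟧S * ⟦ t ⟧S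
  sign-hom Sign.+ t = sym (*-identityˡ _)
  sign-hom Sign.- Sign.+ = sym (*-identityʳ _)
  sign-hom Sign.- Sign.- = begin
      1#               ≈⟨ sym (-‿involutive 1#) ⟩
      - (- 1#)         ≈⟨ -‿cong (sym (*-identityˡ _)) ⟩
      - (1# * - 1#)    ≈⟨ -‿distribˡ-* 1# (- 1#) ⟩
      - 1# * - 1# ∎

  ⟦⟧-◃ : ∀ i → ⟦ i ⟧ℤ ≈ ⟦ ℤ.sign i ⟧S * natK R ℤ.∣ i ∣
  ⟦⟧-◃ i = trans (reflexive (≡.cong ⟦_⟧ℤ (≡.sym (ℤP.◃-inverse i)))) (◃-hom (ℤ.sign i) ℤ.∣ i ∣)

  *-hom : ∀ i j → ⟦ i ℤ.* j ⟧ℤ ≈ ⟦ i ⟧ℤ * ⟦ j ⟧ℤ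
  *-hom i j = begin
      ⟦ (ℤ.sign i Sign.* ℤ.sign j) ◃ (ℤ.∣ i ∣ ℕ.* ℤ.∣ j ∣) ⟧ℤ
        ≈⟨ ◃-hom (ℤ.sign i Sign.* ℤ.sign j) (ℤ.∣ i ∣ ℕ.* ℤ.∣ j ∣) ⟩
      ⟦ ℤ.sign i Sign.* ℤ.sign j ⟧S * natK R (ℤ.∣ i ∣ ℕ.* ℤ.∣ j ∣)
        ≈⟨ *-cong (sign-hom (ℤ.sign i) (ℤ.sign j)) (natK-* ℤ.∣ i ∣ ℤ.∣ j ∣) ⟩
      (⟦ ℤ.sign i ⟧S * ⟦ ℤ.sign j ⟧S) * (natK R ℤ.∣ i ∣ * natK R ℤ.∣ j ∣)
        ≈⟨ interchange _ _ _ _ ⟩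
      (⟦ ℤ.sign i ⟧S * natK R ℤ.∣ i ∣) * (⟦ ℤ.sign j ⟧S * natK R ℤ.∣ j ∣)
        ≈⟨ sym (*-cong (⟦⟧-◃ i) (⟦⟧-◃ j)) ⟩
      ⟦ i ⟧ℤ * ⟦ j ⟧ℤ ∎
    where
    open *S using (_⊕_; _⊜_)
    interchange : ∀ a b c d → (a * b) * (c * d) ≈ (a * c) * (b * d)
    interchange = *S.solve 4 (λ a b c d → (a ⊕ b) ⊕ (c ⊕ d) ⊜ (a ⊕ c) ⊕ (b ⊕ d)) refl

  homomorphism : ℤ.+-*-rawRing -Raw-AlmostCommutative⟶ fromCommutativeRing R
  homomorphism = record
    { ⟦_⟧ = ⟦_⟧ℤ ; +-homo = +-hom ; *-homo = *-hom ; -‿homo = neg-hom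
    ; 0-homo = refl ; 1-homo = +-identityʳ 1# }

  coefficient-equality : ∀ i j → Maybe (⟦ i ⟧ℤ ≈ ⟦ j ⟧ℤ)
  coefficient-equality i j with i ℤ.≟ j
  ... | yes ≡.refl = just refl
  ... | no _ = nothing

  open import Algebra.Solver.Ring ℤ.+-*-rawRing (fromCommutativeRing R) homomorphism coefficient-equality public

-- The ring, n and ζn are module parameters only because
-- Setup (where sumF and det live) is parameterised by them.
module Determinants {c ℓ} (K : CommutativeRing c ℓ) (n : ℕ) {{_ : NonZero n}}
                    (ζn : CommutativeRing.Carrier K) where
  open CommutativeRing K hiding (zero)
  open Setup K n ζn using (Mat; sumF; det; sgn; idM)
  open import Relation.Binary.Reasoning.Setoid setoid
  open import Algebra.Properties.Ring ring using (-‿distribˡ-*; -‿distribʳ-*; -‿involutive)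
  module +S = Algebra.Solver.CommutativeMonoid +-commutativeMonoid
  module *S = Algebra.Solver.CommutativeMonoid *-commutativeMonoid
  open +S using () renaming (_⊕_ to _⊞_; _⊜_ to _⊜⁺_)
  open *S using () renaming (_⊕_ to _⊠_; _⊜_ to _⊜ˣ_)

  if-yes : ∀ {p} {P : Set p} (d : Dec P) {a b : Carrier} → P → (if ⌊ d ⌋ then a else b) ≡ a
  if-yes (yes _) _ = ≡.refl
  if-yes (no ¬p) p = ⊥-elim (¬p p)

  if-no : ∀ {p} {P : Set p} (d : Dec P) {a b : Carrier} → ¬ P → (if ⌊ d ⌋ then a else b) ≡ b
  if-no (yes p) ¬p = ⊥-elim (¬p p)
  if-no (no _) _ = ≡.refl

  sumF-cong : ∀ {m} {f g : Fin m → Carrier} → (∀ i → f i ≈ g i) → sumF f ≈ sumF g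
  sumF-cong {zero} e = refl
  sumF-cong {suc m} e = +-cong (e zero) (sumF-cong (λ i → e (suc i)))

  sumF-zero : ∀ {m} {f : Fin m → Carrier} → (∀ i → f i ≈ 0#) → sumF f ≈ 0#
  sumF-zero {zero} e = refl
  sumF-zero {suc m} e = trans (+-cong (e zero) (sumF-zero (λ i → e (suc i)))) (+-identityˡ 0#)

  sumF-+ : ∀ {m} (f g : Fin m → Carrier) → sumF (λ i → f i + g i) ≈ sumF f + sumF g
  sumF-+ {zero} f g = sym (+-identityˡ 0#)
  sumF-+ {suc m} f g = trans (+-congˡ (sumF-+ (λ i → f (suc i)) (λ i → g (suc i))))
                             (interchange (f zero) (g zero) _ _)
    where
    interchange : ∀ a b c d → (a + b) + (c + d) ≈ (a + c) + (b + d)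
    interchange = +S.solve 4 (λ a b c d → (a ⊞ b) ⊞ (c ⊞ d) ⊜⁺ (a ⊞ c) ⊞ (b ⊞ d)) refl

  sumF-*ˡ : ∀ {m} (a : Carrier) (f : Fin m → Carrier) → sumF (λ i → a * f i) ≈ a * sumF f
  sumF-*ˡ {zero} a f = sym (zeroʳ a)
  sumF-*ˡ {suc m} a f = trans (+-congˡ (sumF-*ˡ a (λ i → f (suc i)))) (sym (distribˡ a _ _))

  sumF-*ʳ : ∀ {m} (a : Carrier) (f : Fin m → Carrier) → sumF (λ i → f i * a) ≈ sumF f * a
  sumF-*ʳ a f = trans (sumF-cong (λ i → *-comm (f i) a)) (trans (sumF-*ˡ a f) (*-comm a (sumF f)))

  sumF-swap : ∀ {m p} (f : Fin m → Fin p → Carrier) →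
              sumF (λ i → sumF (λ j → f i j)) ≈ sumF (λ j → sumF (λ i → f i j))
  sumF-swap {zero} {p} f = sym (sumF-zero {p} (λ j → refl))
  sumF-swap {suc m} {p} f =
    trans (+-congˡ (sumF-swap (λ i j → f (suc i) j)))
          (sym (sumF-+ (λ j → f zero j) (λ j → sumF (λ i → f (suc i) j))))

  sumF-single : ∀ {m} (r : Fin m) (f : Fin m → Carrier) →
                (∀ j → ¬ (j ≡ r) → f j ≈ 0#) → sumF f ≈ f r
  sumF-single zero f off = trans (+-congˡ (sumF-zero (λ i → off (suc i) (λ ())))) (+-identityʳ _)
  sumF-single (suc r) f off =
    trans (+-cong (off zero (λ ()))
                  (sumF-single r (λ i → f (suc i)) (λ j j≢r → off (suc j) (j≢r ∘ FP.suc-injective))))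
          (+-identityˡ _)

  sumF-extract : ∀ {m} (j : Fin (suc m)) (g : Fin (suc m) → Carrier) →
                 sumF g ≈ g j + sumF (λ k → g (punchIn j k))
  sumF-extract zero g = refl
  sumF-extract {suc m} (suc j) g =
    trans (+-congˡ (sumF-extract j (λ i → g (suc i)))) (swap-front _ _ _)
    where
    swap-front : ∀ a b c → a + (b + c) ≈ b + (a + c)
    swap-front = +S.solve 3 (λ a b c → a ⊞ (b ⊞ c) ⊜⁺ b ⊞ (a ⊞ c)) refl

  prodF : ∀ {m} → (Fin m → Carrier) → Carrier
  prodF {zero} f = 1#
  prodF {suc m} f = f zero * prodF (λ i → f (suc i))

  prodF-cong : ∀ {m} {f g : Fin m → Carrier} → (∀ i → f i ≈ g i) → prodF f ≈ prodF g
  prodF-cong {zero} e = refl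
  prodF-cong {suc m} e = *-cong (e zero) (prodF-cong (λ i → e (suc i)))

  det-cong : ∀ {m} {A B : Mat m} → (∀ i j → A i j ≈ B i j) → det A ≈ det B
  det-cong {zero} e = refl
  det-cong {suc m} e = sumF-cong (λ j → *-cong (*-congˡ {sgn (toℕ j)} (e zero j))
                                               (det-cong (λ i k → e (suc i) (punchIn j k))))

  det-rowscale : ∀ {m} (d : Fin m → Carrier) (A : Mat m) →
                 det (λ i j → d i * A i j) ≈ prodF d * det A
  det-rowscale {zero} d A = sym (*-identityˡ 1#)
  det-rowscale {suc m} d A = begin
      sumF (λ j → (sgn (toℕ j) * (d zero * A zero j)) * det (λ i k → d (suc i) * minor j i k))
        ≈⟨ sumF-cong (λ j → *-congˡ {sgn (toℕ j) * (d zero * A zero j)} (det-rowscale (λ i → d (suc i)) (minor j))) ⟩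
      sumF (λ j → (sgn (toℕ j) * (d zero * A zero j)) * (prodF (λ i → d (suc i)) * det (minor j)))
        ≈⟨ sumF-cong (λ j → regroup (sgn (toℕ j)) (d zero) (A zero j) (prodF (λ i → d (suc i))) (det (minor j))) ⟩
      sumF (λ j → prodF d * ((sgn (toℕ j) * A zero j) * det (minor j)))
        ≈⟨ sumF-*ˡ (prodF d) (λ j → (sgn (toℕ j) * A zero j) * det (minor j)) ⟩
      prodF d * det A ∎
    where
    minor : Fin (suc m) → Mat m
    minor j i k = A (suc i) (punchIn j k)
    regroup : ∀ s a b p D → (s * (a * b)) * (p * D) ≈ (a * p) * ((s * b) * D)
    regroup = *S.solve 5 (λ s a b p D → (s ⊠ (a ⊠ b)) ⊠ (p ⊠ D) ⊜ˣ (a ⊠ p) ⊠ ((s ⊠ b) ⊠ D)) refl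

  det-id : ∀ {m} → det (idM {m}) ≈ 1#
  det-id {zero} = refl
  det-id {suc m} = begin
      det (idM {suc m})
        ≈⟨ sumF-single zero _ (λ j j≢0 → off-diagonal j (λ e → j≢0 (≡.sym e))) ⟩
      (1# * 1#) * det (λ i k → idM {suc m} (suc i) (suc k))
        ≈⟨ *-cong (*-identityˡ 1#) (det-cong {m} {λ i k → idM (suc i) (suc k)} {idM} (λ i k → reflexive (idM-suc i k))) ⟩
      1# * det (idM {m})
        ≈⟨ trans (*-identityˡ (det (idM {m}))) (det-id {m}) ⟩
      1# ∎
    where
    idM-suc : ∀ {m} (i k : Fin m) → idM (suc i) (suc k) ≡ idM i k
    idM-suc i k with i Fin.≟ k
    ... | yes _ = ≡.refl
    ... | no _ = ≡.refl
    off-diagonal : ∀ j → ¬ (zero ≡ j) →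
      (sgn (toℕ j) * idM zero j) * det (λ i k → idM {suc m} (suc i) (punchIn j k)) ≈ 0#
    off-diagonal j 0≢j =
      trans (*-congʳ (trans (*-congˡ {sgn (toℕ j)} (reflexive (if-no (zero Fin.≟ j) 0≢j))) (zeroʳ _)))
            (zeroˡ _)

  sgn-+ : ∀ a b → sgn (a ℕ.+ b) ≈ sgn a * sgn b
  sgn-+ zero b = sym (*-identityˡ _)
  sgn-+ (suc a) b = trans (-‿cong (sgn-+ a b)) (-‿distribˡ-* (sgn a) (sgn b))

  sgn-sq : ∀ a → sgn a * sgn a ≈ 1#
  sgn-sq zero = *-identityˡ 1#
  sgn-sq (suc a) = begin
      (- sgn a) * (- sgn a) ≈⟨ sym (-‿distribˡ-* (sgn a) (- sgn a)) ⟩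
      - (sgn a * - sgn a)   ≈⟨ -‿cong (sym (-‿distribʳ-* (sgn a) (sgn a))) ⟩
      - (- (sgn a * sgn a)) ≈⟨ -‿involutive _ ⟩
      sgn a * sgn a         ≈⟨ sgn-sq a ⟩
      1# ∎

  sgn-parity : ∀ x y e → x ℕ.+ y ≡ e ℕ.+ e → sgn x ≈ sgn y
  sgn-parity x y e x+y≡e+e = begin
      sgn x                     ≈⟨ sym (*-identityʳ _) ⟩
      sgn x * 1#                ≈⟨ *-congˡ {sgn x} (sym (sgn-sq y)) ⟩
      sgn x * (sgn y * sgn y)   ≈⟨ sym (*-assoc _ _ _) ⟩
      (sgn x * sgn y) * sgn y   ≈⟨ *-congʳ (sym (sgn-+ x y)) ⟩
      sgn (x ℕ.+ y) * sgn y     ≡⟨ ≡.cong (λ k → sgn k * sgn y) x+y≡e+e ⟩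
      sgn (e ℕ.+ e) * sgn y     ≈⟨ *-congʳ (trans (sgn-+ e e) (sgn-sq e)) ⟩
      1# * sgn y                ≈⟨ *-identityˡ _ ⟩
      sgn y ∎

  -- Removing column a and then column k of what is left, versus removing
  -- column b = punchIn a k and then column k' (where punchIn b k' = a):
  -- both leave the same columns, in the same order ...
  punchIn-exchange : ∀ {m} (a : Fin (suc (suc m))) (k k' : Fin (suc m)) →
                     punchIn (punchIn a k) k' ≡ a →
                     ∀ l → punchIn a (punchIn k l) ≡ punchIn (punchIn a k) (punchIn k' l)
  punchIn-exchange zero k zero _ l = ≡.refl
  punchIn-exchange (suc a) zero k' eq l = ≡.cong (λ x → suc (punchIn x l)) (≡.sym (FP.suc-injective eq))
  punchIn-exchange {suc m} (suc a) (suc k) (suc k') eq zero = ≡.refl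
  punchIn-exchange {suc m} (suc a) (suc k) (suc k') eq (suc l) =
    ≡.cong suc (punchIn-exchange a k k' (FP.suc-injective eq) l)

  -- ... and the four positions involved have an odd sum (which makes the
  -- signs of the corresponding terms of two double Laplace expansions agree).
  punchIn-exchange-parity : ∀ {m} (a : Fin (suc (suc m))) (k k' : Fin (suc m)) →
    punchIn (punchIn a k) k' ≡ a →
    ∃ λ t → toℕ a ℕ.+ toℕ k ℕ.+ (toℕ (punchIn a k) ℕ.+ toℕ k') ≡ suc (t ℕ.+ t)
  punchIn-exchange-parity zero k zero _ = toℕ k , solve 1 (λ x → x :+ ((con 1 :+ x) :+ con 0) := con 1 :+ (x :+ x)) ≡.refl (toℕ k)
    where open +-*-Solver
  punchIn-exchange-parity (suc a) zero k' eq rewrite FP.suc-injective eq =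
    toℕ a , solve 1 (λ x → ((con 1 :+ x) :+ con 0) :+ x := con 1 :+ (x :+ x)) ≡.refl (toℕ a)
    where open +-*-Solver
  punchIn-exchange-parity {suc m} (suc a) (suc k) (suc k') eq
    with punchIn-exchange-parity a k k' (FP.suc-injective eq)
  ... | t , odd = suc (suc t) , ≡.trans (shift (toℕ a) (toℕ k) (toℕ (punchIn a k)) (toℕ k'))
                                        (≡.trans (≡.cong (4 ℕ.+_) odd) (regroup t))
    where
    open +-*-Solver
    shift : ∀ x y z w → suc x ℕ.+ suc y ℕ.+ (suc z ℕ.+ suc w) ≡ 4 ℕ.+ (x ℕ.+ y ℕ.+ (z ℕ.+ w))
    shift = solve 4 (λ x y z w → (con 1 :+ x) :+ (con 1 :+ y) :+ ((con 1 :+ z) :+ (con 1 :+ w))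
                                 := con 4 :+ (x :+ y :+ (z :+ w))) ≡.refl
    regroup : ∀ t → 4 ℕ.+ suc (t ℕ.+ t) ≡ suc (suc (suc t) ℕ.+ suc (suc t))
    regroup = solve 1 (λ t → con 4 :+ (con 1 :+ (t :+ t)) := con 1 :+ ((con 2 :+ t) :+ (con 2 :+ t))) ≡.refl

  -- A double sum over ordered pairs of distinct indices, written with
  -- either index outermost (the diagonal terms must vanish).
  sumF-offDiagonal : ∀ {m} (F : Fin (suc m) → Fin (suc m) → Carrier) → (∀ a → F a a ≈ 0#) →
    sumF (λ a → sumF (λ k → F a (punchIn a k))) ≈ sumF (λ b → sumF (λ k → F (punchIn b k) b))
  sumF-offDiagonal F diag = begin
      sumF (λ a → sumF (λ k → F a (punchIn a k)))  ≈⟨ sumF-cong (λ a → sym (drop-diagonal (F a) a (diag a))) ⟩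
      sumF (λ a → sumF (λ b → F a b))               ≈⟨ sumF-swap F ⟩
      sumF (λ b → sumF (λ a → F a b))               ≈⟨ sumF-cong (λ b → drop-diagonal (λ a → F a b) b (diag b)) ⟩
      sumF (λ b → sumF (λ k → F (punchIn b k) b))  ∎
    where
    drop-diagonal : ∀ (g : Fin _ → Carrier) a → g a ≈ 0# → sumF g ≈ sumF (λ k → g (punchIn a k))
    drop-diagonal g a ga≈0 = trans (sumF-extract a g) (trans (+-congʳ ga≈0) (+-identityˡ _))

  exchange-signs : ∀ m a k b k' → ∃ (λ t → a ℕ.+ k ℕ.+ (b ℕ.+ k') ≡ suc (t ℕ.+ t)) →
                   sgn a * sgn (m ℕ.+ k) ≈ sgn (suc m ℕ.+ b) * sgn k'
  exchange-signs m a k b k' (t , odd) =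
    trans (sym (sgn-+ a (m ℕ.+ k)))
          (trans (sgn-parity (a ℕ.+ (m ℕ.+ k)) (suc m ℕ.+ b ℕ.+ k') (suc (t ℕ.+ m)) total-even)
                 (sgn-+ (suc m ℕ.+ b) k'))
    where
    open +-*-Solver
    split : ∀ x y z w m → x ℕ.+ (m ℕ.+ y) ℕ.+ (suc m ℕ.+ z ℕ.+ w) ≡ x ℕ.+ y ℕ.+ (z ℕ.+ w) ℕ.+ suc (m ℕ.+ m)
    split = solve 5 (λ x y z w m → x :+ (m :+ y) :+ ((con 1 :+ m) :+ z :+ w)
                                 := x :+ y :+ (z :+ w) :+ (con 1 :+ (m :+ m))) ≡.refl
    join : ∀ t m → suc (t ℕ.+ t) ℕ.+ suc (m ℕ.+ m) ≡ suc (t ℕ.+ m) ℕ.+ suc (t ℕ.+ m)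
    join = solve 2 (λ t m → (con 1 :+ (t :+ t)) :+ (con 1 :+ (m :+ m))
                           := (con 1 :+ (t :+ m)) :+ (con 1 :+ (t :+ m))) ≡.refl
    total-even : a ℕ.+ (m ℕ.+ k) ℕ.+ (suc m ℕ.+ b ℕ.+ k') ≡ suc (t ℕ.+ m) ℕ.+ suc (t ℕ.+ m)
    total-even = ≡.trans (split a k b k' m) (≡.trans (≡.cong (ℕ._+ suc (m ℕ.+ m)) odd) (join t m))

  -- The terms of the two double Laplace expansions of det A (A with at
  -- least two rows): along row 0 and then along the last row, or along
  -- the last row and then along row 0.  Both are indexed by the column a
  -- used in row 0 and the column b used in the last row.
  module DoubleExpansion {m} (A : Mat (suc (suc m))) where
    last : Fin (suc (suc m))
    last = fromℕ (suc m)

    middleMinor : Fin (suc (suc m)) → Fin (suc m) → Carrier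
    middleMinor a k = det (λ i l → A (suc (inject₁ i)) (punchIn a (punchIn k l)))

    lastRowTerm firstLast : Fin (suc (suc m)) → Fin (suc m) → Carrier
    lastRowTerm a k = (sgn (m ℕ.+ toℕ k) * A last (punchIn a k)) * middleMinor a k
    firstLast a k = (sgn (toℕ a) * A zero a) * lastRowTerm a k

    firstRowTerm lastFirst : Fin (suc (suc m)) → Fin (suc m) → Carrier
    firstRowTerm b k' = (sgn (toℕ k') * A zero (punchIn b k')) * middleMinor b k'
    lastFirst b k' = (sgn (suc m ℕ.+ toℕ b) * A last b) * firstRowTerm b k'

    firstLast≈lastFirst : ∀ a k k' → punchIn (punchIn a k) k' ≡ a →
                          firstLast a k ≈ lastFirst (punchIn a k) k'
    firstLast≈lastFirst a k k' exch = begin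
        (sa * x) * ((sk * y) * middleMinor a k)
          ≈⟨ *-congˡ {sa * x} (*-congˡ {sk * y} (det-cong (λ i l →
               reflexive (≡.cong (A (suc (inject₁ i))) (punchIn-exchange a k k' exch l))))) ⟩
        (sa * x) * ((sk * y) * D)
          ≈⟨ exchange sa x sk y D ⟩
        (sa * sk) * ((x * y) * D)
          ≈⟨ *-cong signs (*-congʳ {D} (*-comm x y)) ⟩
        (sb * sk') * ((y * x) * D)
          ≈⟨ sym (exchange sb y sk' x D) ⟩
        (sb * y) * ((sk' * x) * D)
          ≡⟨ ≡.cong (λ c → (sb * y) * ((sk' * A zero c) * D)) (≡.sym exch) ⟩
        lastFirst b k' ∎
      where
      b = punchIn a k
      sa = sgn (toℕ a)
      sk = sgn (m ℕ.+ toℕ k)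
      sb = sgn (suc m ℕ.+ toℕ b)
      sk' = sgn (toℕ k')
      x = A zero a
      y = A last b
      D = middleMinor b k'
      exchange : ∀ p x q y D → (p * x) * ((q * y) * D) ≈ (p * q) * ((x * y) * D)
      exchange = *S.solve 5 (λ p x q y D → (p ⊠ x) ⊠ ((q ⊠ y) ⊠ D) ⊜ˣ (p ⊠ q) ⊠ ((x ⊠ y) ⊠ D)) refl
      signs : sa * sk ≈ sb * sk'
      signs = exchange-signs m (toℕ a) (toℕ k) (toℕ b) (toℕ k') (punchIn-exchange-parity a k k' exch)

    pairTerm : Fin (suc (suc m)) → Fin (suc (suc m)) → Carrier
    pairTerm a b with a Fin.≟ b
    ... | yes _ = 0#
    ... | no a≢b = firstLast a (punchOut a≢b)

    pairTerm-diagonal : ∀ a → pairTerm a a ≈ 0#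
    pairTerm-diagonal a with a Fin.≟ a
    ... | yes _ = refl
    ... | no a≢a = ⊥-elim (a≢a ≡.refl)

    pairTerm-firstLast : ∀ a k → pairTerm a (punchIn a k) ≈ firstLast a k
    pairTerm-firstLast a k with a Fin.≟ punchIn a k
    ... | yes eq = ⊥-elim (FP.punchInᵢ≢i a k (≡.sym eq))
    ... | no _ = reflexive (≡.cong (firstLast a) (≡.trans (FP.punchOut-cong a ≡.refl) (FP.punchOut-punchIn a)))

    pairTerm-lastFirst : ∀ b k' → pairTerm (punchIn b k') b ≈ lastFirst b k'
    pairTerm-lastFirst b k' with punchIn b k' Fin.≟ b
    ... | yes eq = ⊥-elim (FP.punchInᵢ≢i b k' eq)
    ... | no a≢b = trans (firstLast≈lastFirst a (punchOut a≢b) k' (≡.cong (λ c → punchIn c k') b≡))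
                         (reflexive (≡.cong (λ c → lastFirst c k') b≡))
      where
      a = punchIn b k'
      b≡ : punchIn a (punchOut a≢b) ≡ b
      b≡ = FP.punchIn-punchOut a≢b

  det-lastRow : ∀ m (A : Mat (suc m)) →
    det A ≈ sumF (λ j → (sgn (m ℕ.+ toℕ j) * A (fromℕ m) j) * det (λ i k → A (inject₁ i) (punchIn j k)))
  det-lastRow zero A = refl
  det-lastRow (suc m) A = begin
      det A
        ≈⟨ sumF-cong (λ a → *-congˡ {sgn (toℕ a) * A zero a}
                                    (det-lastRow m (λ i k → A (suc i) (punchIn a k)))) ⟩
      sumF (λ a → (sgn (toℕ a) * A zero a) * sumF (lastRowTerm a))
        ≈⟨ sumF-cong (λ a → sym (sumF-*ˡ (sgn (toℕ a) * A zero a) (lastRowTerm a))) ⟩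
      sumF (λ a → sumF (firstLast a))
        ≈⟨ sumF-cong (λ a → sumF-cong (λ k → sym (pairTerm-firstLast a k))) ⟩
      sumF (λ a → sumF (λ k → pairTerm a (punchIn a k)))
        ≈⟨ sumF-offDiagonal pairTerm pairTerm-diagonal ⟩
      sumF (λ b → sumF (λ k → pairTerm (punchIn b k) b))
        ≈⟨ sumF-cong (λ b → sumF-cong (pairTerm-lastFirst b)) ⟩
      sumF (λ b → sumF (lastFirst b))
        ≈⟨ sumF-cong (λ b → sumF-*ˡ (sgn (suc m ℕ.+ toℕ b) * A last b) (firstRowTerm b)) ⟩
      sumF (λ b → (sgn (suc m ℕ.+ toℕ b) * A last b) * det (λ i k → A (inject₁ i) (punchIn b k))) ∎
    where open DoubleExpansion A

  rotate : ∀ {m} → Fin (suc m) → Fin (suc m)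
  rotate {m} zero = fromℕ m
  rotate (suc i) = inject₁ i

  -- With an odd number of rows the rotation is an even permutation.
  det-rotate : ∀ e (A : Mat (suc (e ℕ.+ e))) → det (λ i j → A (rotate i) j) ≈ det A
  det-rotate e A = sym (trans (det-lastRow (e ℕ.+ e) A) (sumF-cong (λ j →
      *-congʳ {det (λ i k → A (inject₁ i) (punchIn j k))}
        (*-congʳ {A (fromℕ (e ℕ.+ e)) j} (sgn-parity (e ℕ.+ e ℕ.+ toℕ j) (toℕ j) (e ℕ.+ toℕ j) (regroup e (toℕ j)))))))
    where
    open +-*-Solver
    regroup : ∀ e t → e ℕ.+ e ℕ.+ t ℕ.+ t ≡ e ℕ.+ t ℕ.+ (e ℕ.+ t)
    regroup = solve 2 (λ e t → e :+ e :+ t :+ t := e :+ t :+ (e :+ t)) ≡.refl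

-- ℤ/nℤ, represented by Fin n with the operations of ZMod, is a commutative
-- ring: each law holds for the representatives up to congruence mod n.
-- This gives a ring solver (with integer coefficients) for identities
-- between exponents.
module ZModRing (n : ℕ) {{_ : NonZero n}} where
  open ZMod n public
  open import Data.Nat.DivMod using (_mod_; %-distribˡ-+; %-distribˡ-*; m%n%n≡m%n; m<n⇒m%n≡m; n%n≡0)
  open import Algebra.Structures using (IsCommutativeRing)
  open ≡ using (sym; trans; cong; cong₂)

  -- Congruence of natural numbers modulo n (a record, so that both sides
  -- can be inferred from a proof).
  infix 4 _≋_
  record _≋_ (x y : ℕ) : Set where
    constructor mod≡
    field mod-eq : x % n ≡ y % n
  open _≋_ public

  ≋-refl : ∀ x → x ≋ x
  ≋-refl x = mod≡ ≡.refl

  ≋-sym : ∀ {x y} → x ≋ y → y ≋ x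
  ≋-sym (mod≡ e) = mod≡ (sym e)

  ≋-trans : ∀ {x y z} → x ≋ y → y ≋ z → x ≋ z
  ≋-trans (mod≡ e) (mod≡ f) = mod≡ (trans e f)

  ≋-reflexive : ∀ {x y} → x ≡ y → x ≋ y
  ≋-reflexive e = mod≡ (cong (_% n) e)

  ≋-+ : ∀ {x x' y y'} → x ≋ x' → y ≋ y' → x ℕ.+ y ≋ x' ℕ.+ y'
  ≋-+ {x} {x'} {y} {y'} (mod≡ e) (mod≡ f) = mod≡
    (trans (%-distribˡ-+ x y n) (trans (cong₂ (λ u v → (u ℕ.+ v) % n) e f) (sym (%-distribˡ-+ x' y' n))))

  ≋-* : ∀ {x x' y y'} → x ≋ x' → y ≋ y' → x ℕ.* y ≋ x' ℕ.* y'
  ≋-* {x} {x'} {y} {y'} (mod≡ e) (mod≡ f) = mod≡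
    (trans (%-distribˡ-* x y n) (trans (cong₂ (λ u v → (u ℕ.* v) % n) e f) (sym (%-distribˡ-* x' y' n))))

  toℕ-mod : ∀ x → toℕ (x mod n) ≋ x
  toℕ-mod x = mod≡ (trans (cong (_% n) (FP.toℕ-fromℕ< _)) (m%n%n≡m%n x n))

  fromRepr : ∀ {a b : Zn} → toℕ a ≋ toℕ b → a ≡ b
  fromRepr {a} {b} (mod≡ e) =
    FP.toℕ-injective (trans (sym (m<n⇒m%n≡m (FP.toℕ<n a))) (trans e (m<n⇒m%n≡m (FP.toℕ<n b))))

  mod-≋ : ∀ {x y} → x ≋ y → x mod n ≡ y mod n
  mod-≋ {x} {y} e = fromRepr (≋-trans (toℕ-mod x) (≋-trans e (≋-sym (toℕ-mod y))))

  private
    +-assoc : ∀ a b c → (a +ₙ b) +ₙ c ≡ a +ₙ (b +ₙ c)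
    +-assoc a b c = mod-≋ (≋-trans (≋-+ (toℕ-mod (toℕ a ℕ.+ toℕ b)) (≋-refl (toℕ c)))
                          (≋-trans (≋-reflexive (NP.+-assoc (toℕ a) (toℕ b) (toℕ c)))
                                   (≋-+ (≋-refl (toℕ a)) (≋-sym (toℕ-mod (toℕ b ℕ.+ toℕ c))))))

    *-assoc : ∀ a b c → (a *ₙ b) *ₙ c ≡ a *ₙ (b *ₙ c)
    *-assoc a b c = mod-≋ (≋-trans (≋-* (toℕ-mod (toℕ a ℕ.* toℕ b)) (≋-refl (toℕ c)))
                          (≋-trans (≋-reflexive (NP.*-assoc (toℕ a) (toℕ b) (toℕ c)))
                                   (≋-* (≋-refl (toℕ a)) (≋-sym (toℕ-mod (toℕ b ℕ.* toℕ c))))))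

    +-comm : ∀ a b → a +ₙ b ≡ b +ₙ a
    +-comm a b = cong (_mod n) (NP.+-comm (toℕ a) (toℕ b))

    *-comm : ∀ a b → a *ₙ b ≡ b *ₙ a
    *-comm a b = cong (_mod n) (NP.*-comm (toℕ a) (toℕ b))

    +-identityˡ : ∀ a → 0ₙ +ₙ a ≡ a
    +-identityˡ a = fromRepr (≋-trans (toℕ-mod (toℕ 0ₙ ℕ.+ toℕ a)) (≋-+ (toℕ-mod 0) (≋-refl (toℕ a))))

    +-identityʳ : ∀ a → a +ₙ 0ₙ ≡ a
    +-identityʳ a = trans (+-comm a 0ₙ) (+-identityˡ a)

    *-identityˡ : ∀ a → 1ₙ *ₙ a ≡ a
    *-identityˡ a = fromRepr (≋-trans (toℕ-mod (toℕ 1ₙ ℕ.* toℕ a))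
                             (≋-trans (≋-* (toℕ-mod 1) (≋-refl (toℕ a))) (≋-reflexive (NP.*-identityˡ (toℕ a)))))

    *-identityʳ : ∀ a → a *ₙ 1ₙ ≡ a
    *-identityʳ a = trans (*-comm a 1ₙ) (*-identityˡ a)

    -‿inverseˡ : ∀ a → (-ₙ a) +ₙ a ≡ 0ₙ
    -‿inverseˡ a = mod-≋ (≋-trans (≋-+ (toℕ-mod (n ℕ.∸ toℕ a)) (≋-refl (toℕ a)))
                         (≋-trans (≋-reflexive (NP.m∸n+n≡m (NP.<⇒≤ (FP.toℕ<n a))))
                                  (mod≡ (trans (n%n≡0 n) (sym (m<n⇒m%n≡m (ℕ.>-nonZero⁻¹ n)))))))

    -‿inverseʳ : ∀ a → a +ₙ (-ₙ a) ≡ 0ₙ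
    -‿inverseʳ a = trans (+-comm a (-ₙ a)) (-‿inverseˡ a)

    distribˡ : ∀ a b c → a *ₙ (b +ₙ c) ≡ (a *ₙ b) +ₙ (a *ₙ c)
    distribˡ a b c = mod-≋ (≋-trans (≋-* (≋-refl (toℕ a)) (toℕ-mod (toℕ b ℕ.+ toℕ c)))
                           (≋-trans (≋-reflexive (NP.*-distribˡ-+ (toℕ a) (toℕ b) (toℕ c)))
                                    (≋-sym (≋-+ (toℕ-mod (toℕ a ℕ.* toℕ b)) (toℕ-mod (toℕ a ℕ.* toℕ c))))))

    distribʳ : ∀ a b c → (b +ₙ c) *ₙ a ≡ (b *ₙ a) +ₙ (c *ₙ a)
    distribʳ a b c = trans (*-comm (b +ₙ c) a) (trans (distribˡ a b c) (cong₂ _+ₙ_ (*-comm a b) (*-comm a c)))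

  isCommutativeRing : IsCommutativeRing _≡_ _+ₙ_ _*ₙ_ -ₙ_ 0ₙ 1ₙ
  isCommutativeRing = record
    { isRing = record
      { +-isAbelianGroup = record
        { isGroup = record
          { isMonoid = record
            { isSemigroup = record
              { isMagma = record { isEquivalence = ≡.isEquivalence ; ∙-cong = cong₂ _+ₙ_ }
              ; assoc = +-assoc }
            ; identity = +-identityˡ , +-identityʳ }
          ; inverse = -‿inverseˡ , -‿inverseʳ
          ; ⁻¹-cong = cong -ₙ_ }
        ; comm = +-comm }
      ; *-cong = cong₂ _*ₙ_
      ; *-assoc = *-assoc
      ; *-identity = *-identityˡ , *-identityʳ
      ; distrib = distribˡ , distribʳ }
    ; *-comm = *-comm }

  ℤ/n : CommutativeRing _ _
  ℤ/n = record { isCommutativeRing = isCommutativeRing }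

  module ℤₙ = CommutativeRing ℤ/n
  module ℤ/n-Solver = IntegerCoefficients ℤ/n

  -- the constant 0 in solver expressions (the constant 1 evaluates to
  -- 1 + 0 rather than 1, so identities involving 1 use the ring laws)
  0ℤ : ∀ {k} → ℤ/n-Solver.Polynomial k
  0ℤ = ℤ/n-Solver.con (+ 0)

module Powers {c ℓ} (K : CommutativeRing c ℓ) where
  open CommutativeRing K hiding (zero)

  powK-+ : ∀ x a b → powK K x (a ℕ.+ b) ≈ powK K x a * powK K x b
  powK-+ x zero b = sym (*-identityˡ _)
  powK-+ x (suc a) b = trans (*-congˡ {x} (powK-+ x a b)) (sym (*-assoc _ _ _))

  powK-idempotent : ∀ x m → x * x ≈ x → powK K x (suc m) ≈ x
  powK-idempotent x zero _ = *-identityʳ x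
  powK-idempotent x (suc m) xx≈x = trans (*-congˡ {x} (powK-idempotent x m xx≈x)) xx≈x

module Schrodinger {c ℓ} (K : CommutativeRing c ℓ) (isField : IsField K) (e : ℕ)
                   (ζn : CommutativeRing.Carrier K) (prim : PrimitiveRoot K (suc (e ℕ.+ e)) ζn) where
  n : ℕ
  n = suc (e ℕ.+ e)

  open CommutativeRing K hiding (zero)
  open Setup K n ζn
  open Determinants K n ζn
  open Powers K
  open ZModRing n using (_≋_; mod≡; mod-eq; ≋-refl; ≋-sym; ≋-trans; ≋-+; ≋-reflexive;
                         toℕ-mod; fromRepr; mod-≋; module ℤₙ; module ℤ/n-Solver; 0ℤ)
  open import Data.Nat.DivMod using (_mod_; m≡m%n+[m/n]*n)
  open import Relation.Binary.Reasoning.Setoid setoid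

  ζ^_ : ℕ → Carrier
  ζ^ a = powK K ζn a

  ζ^-multiple : ∀ q → ζ^ (q ℕ.* n) ≈ 1#
  ζ^-multiple zero = refl
  ζ^-multiple (suc q) = trans (powK-+ ζn n (q ℕ.* n)) (trans (*-cong (proj₁ prim) (ζ^-multiple q)) (*-identityˡ 1#))

  ζ^-mod : ∀ a → ζ^ a ≈ ζ^ (a % n)
  ζ^-mod a = begin
      ζ^ a                              ≡⟨ ≡.cong ζ^_ (m≡m%n+[m/n]*n a n) ⟩
      ζ^ (a % n ℕ.+ (a ℕ./ n) ℕ.* n)    ≈⟨ powK-+ ζn (a % n) _ ⟩
      ζ^ (a % n) * ζ^ ((a ℕ./ n) ℕ.* n) ≈⟨ *-congˡ {ζ^ (a % n)} (ζ^-multiple (a ℕ./ n)) ⟩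
      ζ^ (a % n) * 1#                   ≈⟨ *-identityʳ _ ⟩
      ζ^ (a % n) ∎

  ζ^-cong : ∀ {a b} → a ≋ b → ζ^ a ≈ ζ^ b
  ζ^-cong {a} {b} a≋b = trans (ζ^-mod a) (trans (reflexive (≡.cong ζ^_ (mod-eq a≋b))) (sym (ζ^-mod b)))

  ζ^ₙ_ : Zn → Carrier
  ζ^ₙ a = ζ^ toℕ a

  ζ^ₙ-+ : ∀ a b → ζ^ₙ a * ζ^ₙ b ≈ ζ^ₙ (a +ₙ b)
  ζ^ₙ-+ a b = trans (sym (powK-+ ζn (toℕ a) (toℕ b))) (ζ^-cong (≋-sym (toℕ-mod (toℕ a ℕ.+ toℕ b))))

  ζ^ₙ-* : ∀ a b → ζ^ (toℕ a ℕ.* toℕ b) ≈ ζ^ₙ (a *ₙ b)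
  ζ^ₙ-* a b = ζ^-cong (≋-sym (toℕ-mod (toℕ a ℕ.* toℕ b)))

  ≈M-setoid : Setoid c ℓ
  ≈M-setoid = record
    { Carrier = Mat n
    ; _≈_ = _≈M_
    ; isEquivalence = record
      { refl = λ i j → refl
      ; sym = λ A≈B i j → sym (A≈B i j)
      ; trans = λ A≈B B≈C i j → trans (A≈B i j) (B≈C i j) } }

  module M = Setoid ≈M-setoid
  module M-Reasoning = Relation.Binary.Reasoning.Setoid ≈M-setoid

  ⊗-cong : ∀ {A A' B B'} → A ≈M A' → B ≈M B' → (A ⊗ B) ≈M (A' ⊗ B')
  ⊗-cong A≈A' B≈B' i j = sumF-cong (λ k → *-cong (A≈A' i k) (B≈B' k j))

  ⊗-congˡ : ∀ A {B B'} → B ≈M B' → (A ⊗ B) ≈M (A ⊗ B')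
  ⊗-congˡ A = ⊗-cong (M.refl {A})

  ⊗-congʳ : ∀ B {A A'} → A ≈M A' → (A ⊗ B) ≈M (A' ⊗ B)
  ⊗-congʳ B A≈A' = ⊗-cong A≈A' (M.refl {B})

  ⊗-assoc : ∀ A B C → ((A ⊗ B) ⊗ C) ≈M (A ⊗ (B ⊗ C))
  ⊗-assoc A B C i l = begin
      sumF (λ k → sumF (λ j → A i j * B j k) * C k l)
        ≈⟨ sumF-cong (λ k → trans (sym (sumF-*ʳ (C k l) (λ j → A i j * B j k)))
                                  (sumF-cong (λ j → *-assoc (A i j) (B j k) (C k l)))) ⟩
      sumF (λ k → sumF (λ j → A i j * (B j k * C k l)))
        ≈⟨ sumF-swap (λ k j → A i j * (B j k * C k l)) ⟩
      sumF (λ j → sumF (λ k → A i j * (B j k * C k l)))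
        ≈⟨ sumF-cong (λ j → sumF-*ˡ (A i j) (λ k → B j k * C k l)) ⟩
      sumF (λ j → A i j * sumF (λ k → B j k * C k l)) ∎

  ⊗-identityˡ : ∀ A → (idM ⊗ A) ≈M A
  ⊗-identityˡ A i j =
    trans (sumF-single i (λ k → idM i k * A k j)
             (λ k k≢i → trans (*-congʳ {A k j} (reflexive (if-no (i Fin.≟ k) (k≢i ∘ ≡.sym)))) (zeroˡ _)))
          (trans (*-congʳ {A i j} (reflexive (if-yes (i Fin.≟ i) ≡.refl))) (*-identityˡ _))

  ⊗-identityʳ : ∀ A → (A ⊗ idM) ≈M A
  ⊗-identityʳ A i j =
    trans (sumF-single j (λ k → A i k * idM k j)
             (λ k k≢j → trans (*-congˡ {A i k} (reflexive (if-no (k Fin.≟ j) k≢j))) (zeroʳ _)))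
          (trans (*-congˡ {A i j} (reflexive (if-yes (j Fin.≟ j) ≡.refl))) (*-identityʳ _))

  θ₀ : H → Mat n
  θ₀ (hei z x y) r i = if ⌊ r Fin.≟ (i +ₙ y) ⌋ then ζ^ₙ (z +ₙ (x *ₙ r)) else 0#

  σ-entry τ-entry : ℕ → Mat n
  σ-entry x r i = if ⌊ r Fin.≟ i ⌋ then ζ^ (x ℕ.* toℕ i) else 0#
  τ-entry y r i = if ⌊ r Fin.≟ ((toℕ i ℕ.+ y) mod n) ⌋ then 1# else 0#

  θσ-pow : ∀ x → powM θσ x ≈M σ-entry x
  θσ-pow zero r i = refl
  θσ-pow (suc x) r i = begin
      sumF (λ j → θσ r j * powM θσ x j i)
        ≈⟨ sumF-single r (λ j → θσ r j * powM θσ x j i)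
             (λ j j≢r → trans (*-congʳ {powM θσ x j i} (reflexive (if-no (r Fin.≟ j) (j≢r ∘ ≡.sym)))) (zeroˡ _)) ⟩
      θσ r r * powM θσ x r i
        ≈⟨ *-cong (reflexive (if-yes (r Fin.≟ r) ≡.refl)) (θσ-pow x r i) ⟩
      ζ^ toℕ r * σ-entry x r i
        ≈⟨ step (r Fin.≟ i) ⟩
      σ-entry (suc x) r i ∎
    where
    step : (d : Dec (r ≡ i)) → ζ^ toℕ r * (if ⌊ d ⌋ then ζ^ (x ℕ.* toℕ i) else 0#)
                                ≈ (if ⌊ d ⌋ then ζ^ (suc x ℕ.* toℕ i) else 0#)
    step (yes ≡.refl) = sym (powK-+ ζn (toℕ r) (x ℕ.* toℕ r))
    step (no _) = zeroʳ _

  θτ-pow : ∀ y → powM θτ y ≈M τ-entry y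
  θτ-pow zero r i = reflexive (≡.cong (λ t → if ⌊ r Fin.≟ t ⌋ then 1# else 0#) (≡.sym i+0≡i))
    where
    i+0≡i : (toℕ i ℕ.+ 0) mod n ≡ i
    i+0≡i = fromRepr (≋-trans (toℕ-mod (toℕ i ℕ.+ 0)) (≋-reflexive (NP.+-identityʳ (toℕ i))))
  θτ-pow (suc y) r i = begin
      sumF (λ j → θτ r j * powM θτ y j i)
        ≈⟨ sumF-cong (λ j → *-congˡ {θτ r j} (θτ-pow y j i)) ⟩
      sumF (λ j → θτ r j * τ-entry y j i)
        ≈⟨ sumF-single s (λ j → θτ r j * τ-entry y j i)
             (λ j j≢s → trans (*-congˡ {θτ r j} (reflexive (if-no (j Fin.≟ s) j≢s))) (zeroʳ _)) ⟩
      θτ r s * τ-entry y s i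
        ≈⟨ trans (*-congˡ {θτ r s} (reflexive (if-yes (s Fin.≟ s) ≡.refl))) (*-identityʳ _) ⟩
      θτ r s
        ≡⟨ ≡.cong (λ t → if ⌊ r Fin.≟ t ⌋ then 1# else 0#) s+1 ⟩
      τ-entry (suc y) r i ∎
    where
    s = (toℕ i ℕ.+ y) mod n
    s+1 : s +ₙ 1ₙ ≡ (toℕ i ℕ.+ suc y) mod n
    s+1 = mod-≋ (≋-trans (≋-+ (toℕ-mod (toℕ i ℕ.+ y)) (toℕ-mod 1))
                         (≋-reflexive (≡.trans (NP.+-assoc (toℕ i) y 1) (≡.cong (toℕ i ℕ.+_) (NP.+-comm y 1)))))

  θ-closed : ∀ h → θ h ≈M θ₀ h
  θ-closed (hei z x y) r i = begin
      ζ^ toℕ z * sumF (λ j → powM θσ (toℕ x) r j * powM θτ (toℕ y) j i)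
        ≈⟨ *-congˡ {ζ^ toℕ z} (sumF-cong (λ j → *-cong (θσ-pow (toℕ x) r j) (θτ-pow (toℕ y) j i))) ⟩
      ζ^ toℕ z * sumF (λ j → σ-entry (toℕ x) r j * τ-entry (toℕ y) j i)
        ≈⟨ *-congˡ {ζ^ toℕ z} (sumF-single r (λ j → σ-entry (toℕ x) r j * τ-entry (toℕ y) j i)
              (λ j j≢r → trans (*-congʳ {τ-entry (toℕ y) j i} (reflexive (if-no (r Fin.≟ j) (j≢r ∘ ≡.sym))))
                               (zeroˡ _))) ⟩
      ζ^ toℕ z * (σ-entry (toℕ x) r r * τ-entry (toℕ y) r i)
        ≈⟨ *-congˡ {ζ^ toℕ z} (*-congʳ {τ-entry (toℕ y) r i} (reflexive (if-yes (r Fin.≟ r) ≡.refl))) ⟩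
      ζ^ toℕ z * (ζ^ (toℕ x ℕ.* toℕ r) * τ-entry (toℕ y) r i)
        ≈⟨ step (r Fin.≟ (i +ₙ y)) ⟩
      θ₀ (hei z x y) r i ∎
    where
    step : (d : Dec (r ≡ i +ₙ y)) →
           ζ^ toℕ z * (ζ^ (toℕ x ℕ.* toℕ r) * (if ⌊ d ⌋ then 1# else 0#))
           ≈ (if ⌊ d ⌋ then ζ^ₙ (z +ₙ (x *ₙ r)) else 0#)
    step (yes _) = trans (*-congˡ {ζ^ toℕ z} (trans (*-identityʳ _) (ζ^ₙ-* x r))) (ζ^ₙ-+ z (x *ₙ r))
    step (no _) = trans (*-congˡ {ζ^ toℕ z} (zeroʳ _)) (zeroʳ _)

  θ⊗-rows : ∀ z x y A r j → (θ (hei z x y) ⊗ A) r j ≈ ζ^ₙ (z +ₙ (x *ₙ r)) * A (r +ₙ (-ₙ y)) j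
  θ⊗-rows z x y A r j = begin
      sumF (λ i → θ (hei z x y) r i * A i j)
        ≈⟨ sumF-cong (λ i → *-congʳ {A i j} (θ-closed (hei z x y) r i)) ⟩
      sumF (λ i → θ₀ (hei z x y) r i * A i j)
        ≈⟨ sumF-single (r +ₙ (-ₙ y)) (λ i → θ₀ (hei z x y) r i * A i j)
             (λ i i≢r-y → trans (*-congʳ {A i j} (reflexive (if-no (r Fin.≟ (i +ₙ y))
                                   (λ r≡i+y → i≢r-y (≡.trans (≡.sym (cancel i y)) (≡.cong (_+ₙ (-ₙ y)) (≡.sym r≡i+y)))))))
                                (zeroˡ _)) ⟩
      θ₀ (hei z x y) r (r +ₙ (-ₙ y)) * A (r +ₙ (-ₙ y)) j
        ≡⟨ ≡.cong (_* A (r +ₙ (-ₙ y)) j) (if-yes (r Fin.≟ ((r +ₙ (-ₙ y)) +ₙ y)) (uncancel r y)) ⟩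
      ζ^ₙ (z +ₙ (x *ₙ r)) * A (r +ₙ (-ₙ y)) j ∎
    where
    open ℤ/n-Solver
    cancel : ∀ i y → (i +ₙ y) +ₙ (-ₙ y) ≡ i
    cancel = solve 2 (λ i y → (i :+ y) :+ (:- y) := i) ≡.refl
    uncancel : ∀ r y → r ≡ (r +ₙ (-ₙ y)) +ₙ y
    uncancel = solve 2 (λ r y → r := (r :+ (:- y)) :+ y) ≡.refl

  ⊗θ-columns : ∀ z x y A r i → (A ⊗ θ (hei z x y)) r i ≈ A r (i +ₙ y) * ζ^ₙ (z +ₙ (x *ₙ (i +ₙ y)))
  ⊗θ-columns z x y A r i = begin
      sumF (λ j → A r j * θ (hei z x y) j i)
        ≈⟨ sumF-cong (λ j → *-congˡ {A r j} (θ-closed (hei z x y) j i)) ⟩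
      sumF (λ j → A r j * θ₀ (hei z x y) j i)
        ≈⟨ sumF-single (i +ₙ y) (λ j → A r j * θ₀ (hei z x y) j i)
             (λ j j≢i+y → trans (*-congˡ {A r j} (reflexive (if-no (j Fin.≟ (i +ₙ y)) j≢i+y))) (zeroʳ _)) ⟩
      A r (i +ₙ y) * θ₀ (hei z x y) (i +ₙ y) i
        ≡⟨ ≡.cong (A r (i +ₙ y) *_) (if-yes ((i +ₙ y) Fin.≟ (i +ₙ y)) ≡.refl) ⟩
      A r (i +ₙ y) * ζ^ₙ (z +ₙ (x *ₙ (i +ₙ y))) ∎

  θ-hom : ∀ h h' → θ (h ·H h') ≈M (θ h ⊗ θ h')
  θ-hom (hei z x y) (hei z' x' y') r i = begin
      θ (h ·H h') r i
        ≈⟨ θ-closed (h ·H h') r i ⟩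
      θ₀ (h ·H h') r i
        ≈⟨ entry (r Fin.≟ ((i +ₙ y') +ₙ y)) ⟩
      θ₀ h r (i +ₙ y') * ζ^ₙ (z' +ₙ (x' *ₙ (i +ₙ y')))
        ≈⟨ *-congʳ {ζ^ₙ (z' +ₙ (x' *ₙ (i +ₙ y')))} (sym (θ-closed h r (i +ₙ y'))) ⟩
      θ h r (i +ₙ y') * ζ^ₙ (z' +ₙ (x' *ₙ (i +ₙ y')))
        ≈⟨ sym (⊗θ-columns z' x' y' (θ h) r i) ⟩
      (θ h ⊗ θ h') r i ∎
    where
    h = hei z x y
    h' = hei z' x' y'
    open ℤ/n-Solver
    exponent : ∀ z z' x x' y y' i → ((z +ₙ z') +ₙ (-ₙ (x' *ₙ y))) +ₙ ((x +ₙ x') *ₙ ((i +ₙ y') +ₙ y)) ≡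
                                    (z +ₙ (x *ₙ ((i +ₙ y') +ₙ y))) +ₙ (z' +ₙ (x' *ₙ (i +ₙ y')))
    exponent = solve 7 (λ z z' x x' y y' i → ((z :+ z') :+ (:- (x' :* y))) :+ ((x :+ x') :* ((i :+ y') :+ y))
                                        := (z :+ (x :* ((i :+ y') :+ y))) :+ (z' :+ (x' :* (i :+ y')))) ≡.refl
    shift : ∀ i y y' → (i +ₙ y') +ₙ y ≡ i +ₙ (y +ₙ y')
    shift = solve 3 (λ i y y' → (i :+ y') :+ y := i :+ (y :+ y')) ≡.refl
    entry : (d : Dec (r ≡ (i +ₙ y') +ₙ y)) →
            θ₀ (h ·H h') r i ≈ (if ⌊ d ⌋ then ζ^ₙ (z +ₙ (x *ₙ r)) else 0#) * ζ^ₙ (z' +ₙ (x' *ₙ (i +ₙ y')))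
    entry (yes ≡.refl) = begin
        θ₀ (h ·H h') r i
          ≡⟨ if-yes (r Fin.≟ (i +ₙ (y +ₙ y'))) (shift i y y') ⟩
        ζ^ₙ (((z +ₙ z') +ₙ (-ₙ (x' *ₙ y))) +ₙ ((x +ₙ x') *ₙ r))
          ≡⟨ ≡.cong ζ^ₙ_ (exponent z z' x x' y y' i) ⟩
        ζ^ₙ ((z +ₙ (x *ₙ r)) +ₙ (z' +ₙ (x' *ₙ (i +ₙ y'))))
          ≈⟨ sym (ζ^ₙ-+ (z +ₙ (x *ₙ r)) (z' +ₙ (x' *ₙ (i +ₙ y')))) ⟩
        ζ^ₙ (z +ₙ (x *ₙ r)) * ζ^ₙ (z' +ₙ (x' *ₙ (i +ₙ y'))) ∎
    entry (no r≢) = trans (reflexive (if-no (r Fin.≟ (i +ₙ (y +ₙ y'))) (λ eq → r≢ (≡.trans eq (≡.sym (shift i y y'))))))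
                          (sym (zeroˡ _))

  θ-unit : θ eH ≈M idM
  θ-unit r i = trans (θ-closed eH r i) (entry (r Fin.≟ (i +ₙ 0ₙ)) (r Fin.≟ i))
    where
    open ℤ/n-Solver
    i+0≡i : i +ₙ 0ₙ ≡ i
    i+0≡i = solve 1 (λ i → i :+ 0ℤ := i) ≡.refl i
    entry : (d : Dec (r ≡ i +ₙ 0ₙ)) (d' : Dec (r ≡ i)) →
            (if ⌊ d ⌋ then ζ^ₙ (0ₙ +ₙ (0ₙ *ₙ r)) else 0#) ≈ (if ⌊ d' ⌋ then 1# else 0#)
    entry (yes _) (yes _) = refl
    entry (yes r≡) (no r≢) = ⊥-elim (r≢ (≡.trans r≡ i+0≡i))
    entry (no r≢) (yes r≡) = ⊥-elim (r≢ (≡.trans r≡ (≡.sym i+0≡i)))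
    entry (no _) (no _) = refl

  triangle : ℕ → ℕ
  triangle zero = 0
  triangle (suc m) = m ℕ.+ triangle m

  triangle-double : ∀ m → 2 ℕ.* triangle m ℕ.+ m ≡ m ℕ.* m
  triangle-double zero = ≡.refl
  triangle-double (suc m) = ≡.trans (regroup m (triangle m))
                                    (≡.trans (≡.cong (ℕ._+ (2 ℕ.* m ℕ.+ 1)) (triangle-double m)) (square m))
    where
    open +-*-Solver
    regroup : ∀ m t → 2 ℕ.* (m ℕ.+ t) ℕ.+ suc m ≡ (2 ℕ.* t ℕ.+ m) ℕ.+ (2 ℕ.* m ℕ.+ 1)
    regroup = solve 2 (λ m t → con 2 :* (m :+ t) :+ (con 1 :+ m) := (con 2 :* t :+ m) :+ (con 2 :* m :+ con 1)) ≡.refl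
    square : ∀ m → m ℕ.* m ℕ.+ (2 ℕ.* m ℕ.+ 1) ≡ suc m ℕ.* suc m
    square = solve 1 (λ m → m :* m :+ (con 2 :* m :+ con 1) := (con 1 :+ m) :* (con 1 :+ m)) ≡.refl

  triangle-n : triangle n ≡ e ℕ.* n
  triangle-n = NP.*-cancelˡ-≡ (triangle n) (e ℕ.* n) 2
                 (NP.+-cancelʳ-≡ _ _ _ (≡.trans (triangle-double n) (expand n e)))
    where
    open +-*-Solver
    expand : ∀ n e → n ℕ.* suc (e ℕ.+ e) ≡ 2 ℕ.* (e ℕ.* n) ℕ.+ n
    expand = solve 2 (λ n e → n :* (con 1 :+ (e :+ e)) := con 2 :* (e :* n) :+ n) ≡.refl

  prod-ζ^-linear : ∀ m a b → prodF {m} (λ r → ζ^ (a ℕ.+ b ℕ.* toℕ r)) ≈ ζ^ (m ℕ.* a ℕ.+ b ℕ.* triangle m)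
  prod-ζ^-linear zero a b = reflexive (≡.cong ζ^_ (≡.sym (NP.*-zeroʳ b)))
  prod-ζ^-linear (suc m) a b = begin
      ζ^ (a ℕ.+ b ℕ.* 0) * prodF {m} (λ r → ζ^ (a ℕ.+ b ℕ.* suc (toℕ r)))
        ≈⟨ *-congˡ {ζ^ (a ℕ.+ b ℕ.* 0)} (prodF-cong {m} (λ r → reflexive (≡.cong ζ^_ (step a b (toℕ r))))) ⟩
      ζ^ (a ℕ.+ b ℕ.* 0) * prodF {m} (λ r → ζ^ ((a ℕ.+ b) ℕ.+ b ℕ.* toℕ r))
        ≈⟨ *-congˡ {ζ^ (a ℕ.+ b ℕ.* 0)} (prod-ζ^-linear m (a ℕ.+ b) b) ⟩
      ζ^ (a ℕ.+ b ℕ.* 0) * ζ^ (m ℕ.* (a ℕ.+ b) ℕ.+ b ℕ.* triangle m)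
        ≈⟨ sym (powK-+ ζn (a ℕ.+ b ℕ.* 0) (m ℕ.* (a ℕ.+ b) ℕ.+ b ℕ.* triangle m)) ⟩
      ζ^ ((a ℕ.+ b ℕ.* 0) ℕ.+ (m ℕ.* (a ℕ.+ b) ℕ.+ b ℕ.* triangle m))
        ≡⟨ ≡.cong ζ^_ (collect a b m (triangle m)) ⟩
      ζ^ (suc m ℕ.* a ℕ.+ b ℕ.* triangle (suc m)) ∎
    where
    open +-*-Solver
    step : ∀ a b t → a ℕ.+ b ℕ.* suc t ≡ (a ℕ.+ b) ℕ.+ b ℕ.* t
    step = solve 3 (λ a b t → a :+ b :* (con 1 :+ t) := (a :+ b) :+ b :* t) ≡.refl
    collect : ∀ a b m t → (a ℕ.+ b ℕ.* 0) ℕ.+ (m ℕ.* (a ℕ.+ b) ℕ.+ b ℕ.* t) ≡ suc m ℕ.* a ℕ.+ b ℕ.* (m ℕ.+ t)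
    collect = solve 4 (λ a b m t → (a :+ b :* con 0) :+ (m :* (a :+ b) :+ b :* t)
                                  := (con 1 :+ m) :* a :+ b :* (m :+ t)) ≡.refl

  prod-ζ^ₙ-period : ∀ z x → prodF {n} (λ r → ζ^ₙ (z +ₙ (x *ₙ r))) ≈ 1#
  prod-ζ^ₙ-period z x = begin
      prodF {n} (λ r → ζ^ₙ (z +ₙ (x *ₙ r)))
        ≈⟨ prodF-cong {n} (λ r → ζ^-cong (≋-trans (toℕ-mod (toℕ z ℕ.+ toℕ (x *ₙ r)))
                                              (≋-+ (≋-refl (toℕ z)) (toℕ-mod (toℕ x ℕ.* toℕ r))))) ⟩
      prodF {n} (λ r → ζ^ (toℕ z ℕ.+ toℕ x ℕ.* toℕ r))
        ≈⟨ prod-ζ^-linear n (toℕ z) (toℕ x) ⟩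
      ζ^ (n ℕ.* toℕ z ℕ.+ toℕ x ℕ.* triangle n)
        ≡⟨ ≡.cong (λ t → ζ^ (n ℕ.* toℕ z ℕ.+ toℕ x ℕ.* t)) triangle-n ⟩
      ζ^ (n ℕ.* toℕ z ℕ.+ toℕ x ℕ.* (e ℕ.* n))
        ≡⟨ ≡.cong ζ^_ (factor n (toℕ z) (toℕ x) e) ⟩
      ζ^ ((toℕ z ℕ.+ toℕ x ℕ.* e) ℕ.* n)
        ≈⟨ ζ^-multiple (toℕ z ℕ.+ toℕ x ℕ.* e) ⟩
      1# ∎
    where
    open +-*-Solver
    factor : ∀ n a b q → n ℕ.* a ℕ.+ b ℕ.* (q ℕ.* n) ≡ (a ℕ.+ b ℕ.* q) ℕ.* n
    factor = solve 4 (λ n a b q → n :* a :+ b :* (q :* n) := (a :+ b :* q) :* n) ≡.refl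

  rotate-pred : ∀ r → rotate r ≡ r +ₙ (-ₙ 1ₙ)
  rotate-pred r = ≡.trans (solve 2 (λ s o → s := (s :+ o) :+ (:- o)) ≡.refl (rotate r) 1ₙ)
                          (≡.cong (_+ₙ (-ₙ 1ₙ)) (fromRepr (rotate+1 r)))
    where
    open ℤ/n-Solver
    rotate+1 : ∀ r → toℕ (rotate r +ₙ 1ₙ) ≋ toℕ r
    rotate+1 zero =
      ≋-trans (toℕ-mod (toℕ (fromℕ (e ℕ.+ e)) ℕ.+ toℕ 1ₙ))
              (≋-trans (≋-+ (≋-reflexive (FP.toℕ-fromℕ (e ℕ.+ e))) (toℕ-mod 1))
                       (≋-trans (≋-reflexive (NP.+-comm (e ℕ.+ e) 1)) n≋0))
      where
      n≋0 : n ≋ 0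
      n≋0 = mod≡ (≡.trans (Data.Nat.DivMod.n%n≡0 n)
                          (≡.sym (Data.Nat.DivMod.m<n⇒m%n≡m {n = n} {m = 0} (s≤s z≤n))))
    rotate+1 (suc i) =
      ≋-trans (toℕ-mod (toℕ (inject₁ i) ℕ.+ toℕ 1ₙ))
              (≋-trans (≋-+ (≋-reflexive (FP.toℕ-inject₁ i)) (toℕ-mod 1))
                       (≋-reflexive (NP.+-comm (toℕ i) 1)))

  suc-mod : ∀ t → suc t mod n ≡ (t mod n) +ₙ 1ₙ
  suc-mod t = mod-≋ (≋-trans (≋-reflexive (NP.+-comm 1 t)) (≋-+ (≋-sym (toℕ-mod t)) (≋-sym (toℕ-mod 1))))

  det-shift : ∀ t (A : Mat n) → det (λ r j → A (r +ₙ (-ₙ (t mod n))) j) ≈ det A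
  det-shift zero A = det-cong (λ r j → reflexive (≡.cong (λ s → A s j) (r-0≡r r)))
    where
    open ℤ/n-Solver
    r-0≡r : ∀ r → r +ₙ (-ₙ 0ₙ) ≡ r
    r-0≡r = solve 1 (λ r → r :+ (:- 0ℤ) := r) ≡.refl
  det-shift (suc t) A = begin
      det (λ r j → A (r +ₙ (-ₙ (suc t mod n))) j)
        ≈⟨ det-cong (λ r j → reflexive (≡.cong (λ s → A s j) (shift-step r))) ⟩
      det (λ r j → A (rotate r +ₙ (-ₙ (t mod n))) j)
        ≈⟨ det-rotate e (λ r j → A (r +ₙ (-ₙ (t mod n))) j) ⟩
      det (λ r j → A (r +ₙ (-ₙ (t mod n))) j)
        ≈⟨ det-shift t A ⟩
      det A ∎
    where
    open ℤ/n-Solver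
    shift-step : ∀ r → r +ₙ (-ₙ (suc t mod n)) ≡ rotate r +ₙ (-ₙ (t mod n))
    shift-step r = ≡.trans (≡.cong (λ u → r +ₙ (-ₙ u)) (suc-mod t))
                   (≡.trans (regroup r (t mod n) 1ₙ) (≡.cong (_+ₙ (-ₙ (t mod n))) (≡.sym (rotate-pred r))))
      where
      regroup : ∀ r u o → r +ₙ (-ₙ (u +ₙ o)) ≡ (r +ₙ (-ₙ o)) +ₙ (-ₙ u)
      regroup = solve 3 (λ r u o → r :+ (:- (u :+ o)) := (r :+ (:- o)) :+ (:- u)) ≡.refl

  -- Left multiplication by θ(h) does not change the determinant: it
  -- rescales the rows by factors with product 1 and shifts them cyclically.
  det-θ⊗ : ∀ h (A : Mat n) → det (θ h ⊗ A) ≈ det A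
  det-θ⊗ (hei z x y) A = begin
      det (θ (hei z x y) ⊗ A)
        ≈⟨ det-cong (θ⊗-rows z x y A) ⟩
      det (λ r j → ζ^ₙ (z +ₙ (x *ₙ r)) * A (r +ₙ (-ₙ y)) j)
        ≈⟨ det-rowscale (λ r → ζ^ₙ (z +ₙ (x *ₙ r))) (λ r j → A (r +ₙ (-ₙ y)) j) ⟩
      prodF (λ r → ζ^ₙ (z +ₙ (x *ₙ r))) * det (λ r j → A (r +ₙ (-ₙ y)) j)
        ≈⟨ *-cong (prod-ζ^ₙ-period z x) (det-cong (λ r j → reflexive (≡.cong (λ u → A (r +ₙ (-ₙ u)) j) y≡))) ⟩
      1# * det (λ r j → A (r +ₙ (-ₙ (toℕ y mod n))) j)
        ≈⟨ trans (*-identityˡ _) (det-shift (toℕ y) A) ⟩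
      det A ∎
    where
    y≡ : y ≡ toℕ y mod n
    y≡ = fromRepr (≋-sym (toℕ-mod (toℕ y)))

  ζ^-complement : ∀ a → a ≤ n → ζ^ a * ζ^ (n ℕ.∸ a) ≈ 1#
  ζ^-complement a a≤n = trans (sym (powK-+ ζn a (n ℕ.∸ a)))
                              (trans (reflexive (≡.cong ζ^_ (NP.m+[n∸m]≡n a≤n))) (proj₁ prim))

  ζ^-distinct : ∀ a b → a ℕ.< b → b ℕ.< n → ¬ (ζ^ b ≈ ζ^ a)
  ζ^-distinct a b a<b b<n ζ^b≈ζ^a = proj₂ prim (b ℕ.∸ a) (NP.m<n⇒0<n∸m a<b) (NP.≤-<-trans (NP.m∸n≤m b a) b<n) ζ^d≈1
    where
    d = b ℕ.∸ a
    a≤n = NP.<⇒≤ (NP.<-trans a<b b<n)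
    ζ^d≈1 : ζ^ d ≈ 1#
    ζ^d≈1 = begin
      ζ^ d                         ≈⟨ sym (*-identityʳ _) ⟩
      ζ^ d * 1#                    ≈⟨ *-congˡ {ζ^ d} (sym (ζ^-complement a a≤n)) ⟩
      ζ^ d * (ζ^ a * ζ^ (n ℕ.∸ a)) ≈⟨ sym (*-assoc _ _ _) ⟩
      (ζ^ d * ζ^ a) * ζ^ (n ℕ.∸ a) ≈⟨ *-congʳ (trans (*-comm (ζ^ d) (ζ^ a)) (sym (powK-+ ζn a d))) ⟩
      ζ^ (a ℕ.+ d) * ζ^ (n ℕ.∸ a)  ≡⟨ ≡.cong (λ u → ζ^ u * ζ^ (n ℕ.∸ a)) (NP.m+[n∸m]≡n (NP.<⇒≤ a<b)) ⟩
      ζ^ b * ζ^ (n ℕ.∸ a)          ≈⟨ *-congʳ ζ^b≈ζ^a ⟩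
      ζ^ a * ζ^ (n ℕ.∸ a)          ≈⟨ ζ^-complement a a≤n ⟩
      1# ∎

  ζ^ₙ-injective : ∀ (r i : Fin n) → ¬ (r ≡ i) → ¬ (ζ^ₙ i ≈ ζ^ₙ r)
  ζ^ₙ-injective r i r≢i eq with NP.<-cmp (toℕ i) (toℕ r)
  ... | tri< i<r _ _ = ζ^-distinct (toℕ i) (toℕ r) i<r (FP.toℕ<n r) (sym eq)
  ... | tri≈ _ i≡r _ = r≢i (FP.toℕ-injective (≡.sym i≡r))
  ... | tri> _ _ r<i = ζ^-distinct (toℕ r) (toℕ i) r<i (FP.toℕ<n i) eq

  cancel-nonzero : ∀ m a → ¬ (a ≈ 0#) → m * a ≈ 0# → m ≈ 0#
  cancel-nonzero m a a≉0 ma≈0 with proj₂ isField a a≉0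
  ... | a⁻¹ , aa⁻¹≈1 = begin
      m               ≈⟨ sym (*-identityʳ m) ⟩
      m * 1#          ≈⟨ *-congˡ {m} (sym aa⁻¹≈1) ⟩
      m * (a * a⁻¹)   ≈⟨ sym (*-assoc m a a⁻¹) ⟩
      (m * a) * a⁻¹   ≈⟨ *-congʳ ma≈0 ⟩
      0# * a⁻¹        ≈⟨ zeroˡ a⁻¹ ⟩
      0# ∎

  -- Commuting with θ(σ), whose eigenvalues ζ^i are distinct, forces a
  -- matrix to be diagonal.
  commutes-σ-diagonal : ∀ M → (M ⊗ θ σH) ≈M (θ σH ⊗ M) → ∀ r i → ¬ (r ≡ i) → M r i ≈ 0#
  commutes-σ-diagonal M comm r i r≢i =
    cancel-nonzero (M r i) (ζ^ₙ i - ζ^ₙ r) (λ d≈0 → ζ^ₙ-injective r i r≢i (x∙y⁻¹≈ε⇒x≈y _ _ d≈0)) (begin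
      M r i * (ζ^ₙ i - ζ^ₙ r)           ≈⟨ x[y-z]≈xy-xz (M r i) (ζ^ₙ i) (ζ^ₙ r) ⟩
      M r i * ζ^ₙ i - M r i * ζ^ₙ r     ≈⟨ +-cong eigen (-‿cong (*-comm (M r i) (ζ^ₙ r))) ⟩
      ζ^ₙ r * M r i - ζ^ₙ r * M r i     ≈⟨ -‿inverseʳ _ ⟩
      0# ∎)
    where
    open ℤ/n-Solver
    open import Algebra.Properties.Ring ring using (x[y-z]≈xy-xz)
    open import Algebra.Properties.AbelianGroup +-abelianGroup using (x∙y⁻¹≈ε⇒x≈y)
    unit-exponent : ∀ r → 0ₙ +ₙ (1ₙ *ₙ r) ≡ r
    unit-exponent r = ≡.trans (ℤₙ.+-identityˡ (1ₙ *ₙ r)) (ℤₙ.*-identityˡ r)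
    plus-zero : ∀ r → r +ₙ 0ₙ ≡ r
    plus-zero = solve 1 (λ r → r :+ 0ℤ := r) ≡.refl
    minus-zero : ∀ r → r +ₙ (-ₙ 0ₙ) ≡ r
    minus-zero = solve 1 (λ r → r :+ (:- 0ℤ) := r) ≡.refl
    eigen : M r i * ζ^ₙ i ≈ ζ^ₙ r * M r i
    eigen = begin
      M r i * ζ^ₙ i
        ≡⟨ ≡.cong₂ (λ u v → M r u * ζ^ₙ v) (≡.sym (plus-zero i))
                   (≡.sym (≡.trans (≡.cong (λ u → 0ₙ +ₙ (1ₙ *ₙ u)) (plus-zero i)) (unit-exponent i))) ⟩
      M r (i +ₙ 0ₙ) * ζ^ₙ (0ₙ +ₙ (1ₙ *ₙ (i +ₙ 0ₙ)))
        ≈⟨ sym (⊗θ-columns 0ₙ 1ₙ 0ₙ M r i) ⟩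
      (M ⊗ θ σH) r i
        ≈⟨ comm r i ⟩
      (θ σH ⊗ M) r i
        ≈⟨ θ⊗-rows 0ₙ 1ₙ 0ₙ M r i ⟩
      ζ^ₙ (0ₙ +ₙ (1ₙ *ₙ r)) * M (r +ₙ (-ₙ 0ₙ)) i
        ≡⟨ ≡.cong₂ (λ u v → ζ^ₙ u * M v i) (unit-exponent r) (minus-zero r) ⟩
      ζ^ₙ r * M r i ∎

  -- Commuting with θ(τ), which permutes the basis cyclically, forces the
  -- diagonal of a matrix to be constant.
  commutes-τ-diagonal-step : ∀ M → (M ⊗ θ τH) ≈M (θ τH ⊗ M) → ∀ i → M (i +ₙ 1ₙ) (i +ₙ 1ₙ) ≈ M i i
  commutes-τ-diagonal-step M comm i = begin
      M (i +ₙ 1ₙ) (i +ₙ 1ₙ)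
        ≈⟨ sym (*-identityʳ _) ⟩
      M (i +ₙ 1ₙ) (i +ₙ 1ₙ) * ζ^ₙ 0ₙ
        ≡⟨ ≡.cong (λ u → M (i +ₙ 1ₙ) (i +ₙ 1ₙ) * ζ^ₙ u) (≡.sym (zero-exponent (i +ₙ 1ₙ))) ⟩
      M (i +ₙ 1ₙ) (i +ₙ 1ₙ) * ζ^ₙ (0ₙ +ₙ (0ₙ *ₙ (i +ₙ 1ₙ)))
        ≈⟨ sym (⊗θ-columns 0ₙ 0ₙ 1ₙ M (i +ₙ 1ₙ) i) ⟩
      (M ⊗ θ τH) (i +ₙ 1ₙ) i
        ≈⟨ comm (i +ₙ 1ₙ) i ⟩
      (θ τH ⊗ M) (i +ₙ 1ₙ) i
        ≈⟨ θ⊗-rows 0ₙ 0ₙ 1ₙ M (i +ₙ 1ₙ) i ⟩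
      ζ^ₙ (0ₙ +ₙ (0ₙ *ₙ (i +ₙ 1ₙ))) * M ((i +ₙ 1ₙ) +ₙ (-ₙ 1ₙ)) i
        ≡⟨ ≡.cong₂ (λ u v → ζ^ₙ u * M v i) (zero-exponent (i +ₙ 1ₙ)) (cancel i 1ₙ) ⟩
      ζ^ₙ 0ₙ * M i i
        ≈⟨ *-identityˡ _ ⟩
      M i i ∎
    where
    open ℤ/n-Solver
    zero-exponent : ∀ r → 0ₙ +ₙ (0ₙ *ₙ r) ≡ 0ₙ
    zero-exponent = solve 1 (λ r → 0ℤ :+ (0ℤ :* r) := 0ℤ) ≡.refl
    cancel : ∀ i y → (i +ₙ y) +ₙ (-ₙ y) ≡ i
    cancel = solve 2 (λ i y → (i :+ y) :+ (:- y) := i) ≡.refl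

  commutes-τ-diagonal : ∀ M → (M ⊗ θ τH) ≈M (θ τH ⊗ M) → ∀ a → M a a ≈ M zero zero
  commutes-τ-diagonal M comm a = trans (reflexive (≡.cong (λ u → M u u) (fromRepr (≋-sym (toℕ-mod (toℕ a))))))
                                       (along (toℕ a))
    where
    along : ∀ t → M (t mod n) (t mod n) ≈ M zero zero
    along zero = refl
    along (suc t) = trans (reflexive (≡.cong (λ u → M u u) (suc-mod t)))
                          (trans (commutes-τ-diagonal-step M comm (t mod n)) (along t))

  commutant-scalar : ∀ M → (M ⊗ θ σH) ≈M (θ σH ⊗ M) → (M ⊗ θ τH) ≈M (θ τH ⊗ M) →
                     M ≈M (M zero zero ·s idM)
  commutant-scalar M comm-σ comm-τ r i with r Fin.≟ i
  ... | yes ≡.refl = trans (commutes-τ-diagonal M comm-τ r) (sym (*-identityʳ _))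
  ... | no r≢i = trans (commutes-σ-diagonal M comm-σ r i r≢i) (sym (zeroʳ _))

  det-scalar : ∀ l → det (l ·s idM {n}) ≈ powK K l n
  det-scalar l = trans (det-rowscale (λ _ → l) (idM {n}))
                       (trans (*-congˡ {prodF {n} (λ _ → l)} (det-id {n})) (trans (*-identityʳ _) (prodF-const n)))
    where
    prodF-const : ∀ m → prodF {m} (λ _ → l) ≈ powK K l m
    prodF-const zero = refl
    prodF-const (suc m) = *-congˡ {l} (prodF-const m)

  -- An idempotent of determinant 1 commuting with θ is the identity: it is
  -- a scalar λ with λ² = λ, so λ = λⁿ = det = 1.
  idempotent-commutant-identity : ∀ M → (M ⊗ θ σH) ≈M (θ σH ⊗ M) → (M ⊗ θ τH) ≈M (θ τH ⊗ M) →
                                  (M ⊗ M) ≈M M → det M ≈ 1# → M ≈M idM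
  idempotent-commutant-identity M comm-σ comm-τ idem det≈1 r i =
    trans (scalar r i) (trans (*-congʳ {idM r i} λ≈1) (*-identityˡ _))
    where
    l = M zero zero
    scalar = commutant-scalar M comm-σ comm-τ
    l²≈l : l * l ≈ l
    l²≈l = trans (sym (sumF-single zero (λ k → M zero k * M k zero)
                        (λ k k≢0 → trans (*-congʳ {M k zero} (trans (scalar zero k)
                                            (trans (*-congˡ {l} (reflexive (if-no (zero Fin.≟ k) (k≢0 ∘ ≡.sym))))
                                                   (zeroʳ l))))
                                          (zeroˡ _))))
                 (idem zero zero)
    λ≈1 : l ≈ 1#
    λ≈1 = begin
      l                    ≈⟨ sym (powK-idempotent l (e ℕ.+ e) l²≈l) ⟩
      powK K l n           ≈⟨ sym (det-scalar l) ⟩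
      det (l ·s idM {n})   ≈⟨ sym (det-cong scalar) ⟩
      det M                ≈⟨ det≈1 ⟩
      1# ∎

-- Identities in H_n and SL₂(ℤ/nℤ) for n ≥ 2 (so that 1 ≠ 0 in ℤ/nℤ and
-- s_β can be evaluated on σ and τ).
module GroupIdentities (m : ℕ) where
  open ZModRing (suc (suc m))
  open ≡ using (cong; cong₂; trans; sym)

  hei-cong : ∀ {z z' x x' y y'} → z ≡ z' → x ≡ x' → y ≡ y' → hei z x y ≡ hei z' x' y'
  hei-cong ≡.refl ≡.refl ≡.refl = ≡.refl

  m2-cong : ∀ {a a' b b' c c' d d'} → a ≡ a' → b ≡ b' → c ≡ c' → d ≡ d' → m2 a b c d ≡ m2 a' b' c' d'
  m2-cong ≡.refl ≡.refl ≡.refl ≡.refl = ≡.refl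

  ·H-identityˡ : ∀ h → eH ·H h ≡ h
  ·H-identityˡ (hei z x y) = hei-cong (solve 2 (λ z x → (0ℤ :+ z) :+ (:- (x :* 0ℤ)) := z) ≡.refl z x)
                                      (ℤₙ.+-identityˡ x) (ℤₙ.+-identityˡ y)
    where open ℤ/n-Solver

  ·H-identityʳ : ∀ h → h ·H eH ≡ h
  ·H-identityʳ (hei z x y) = hei-cong (solve 2 (λ z y → (z :+ 0ℤ) :+ (:- (0ℤ :* y)) := z) ≡.refl z y)
                                      (ℤₙ.+-identityʳ x) (ℤₙ.+-identityʳ y)
    where open ℤ/n-Solver

  sβ-unit : ∀ γ → sβ γ eH ≡ eH
  sβ-unit (m2 a b c d) = trans (·H-identityˡ (eH ·H eH)) (·H-identityˡ eH)

  sβ-σ : ∀ a b c d → sβ (m2 a b c d) σH ≡ hei (-ₙ ((a *ₙ c) *ₙ half)) a c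
  sβ-σ a b c d = trans (·H-identityˡ _) (trans (·H-identityʳ _) (·H-identityʳ _))

  sβ-τ : ∀ a b c d → sβ (m2 a b c d) τH ≡ hei (-ₙ ((b *ₙ d) *ₙ half)) b d
  sβ-τ a b c d = trans (·H-identityˡ _) (trans (·H-identityˡ _) (·H-identityʳ _))

  sβ-I-σ : sβ I₂ σH ≡ σH
  sβ-I-σ = trans (sβ-σ 1ₙ 0ₙ 0ₙ 1ₙ) (hei-cong (vanish 1ₙ half) ≡.refl ≡.refl)
    where
    open ℤ/n-Solver
    vanish : ∀ o h → -ₙ ((o *ₙ 0ₙ) *ₙ h) ≡ 0ₙ
    vanish = solve 2 (λ o h → :- ((o :* 0ℤ) :* h) := 0ℤ) ≡.refl

  sβ-I-τ : sβ I₂ τH ≡ τH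
  sβ-I-τ = trans (sβ-τ 1ₙ 0ₙ 0ₙ 1ₙ) (hei-cong (vanish 1ₙ half) ≡.refl ≡.refl)
    where
    open ℤ/n-Solver
    vanish : ∀ o h → -ₙ ((0ₙ *ₙ o) *ₙ h) ≡ 0ₙ
    vanish = solve 2 (λ o h → :- ((0ℤ :* o) :* h) := 0ℤ) ≡.refl

  ·₂-identityˡ : ∀ γ → I₂ ·₂ γ ≡ γ
  ·₂-identityˡ (m2 a b c d) = m2-cong (first a c) (first b d) (second a c) (second b d)
    where
    first : ∀ a c → (1ₙ *ₙ a) +ₙ (0ₙ *ₙ c) ≡ a
    first a c = trans (cong₂ _+ₙ_ (ℤₙ.*-identityˡ a) (ℤₙ.zeroˡ c)) (ℤₙ.+-identityʳ a)
    second : ∀ a c → (0ₙ *ₙ a) +ₙ (1ₙ *ₙ c) ≡ c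
    second a c = trans (cong₂ _+ₙ_ (ℤₙ.zeroˡ a) (ℤₙ.*-identityˡ c)) (ℤₙ.+-identityˡ c)

  ·₂-identityʳ : ∀ γ → γ ·₂ I₂ ≡ γ
  ·₂-identityʳ (m2 a b c d) = m2-cong (first a b) (second a b) (first c d) (second c d)
    where
    first : ∀ a b → (a *ₙ 1ₙ) +ₙ (b *ₙ 0ₙ) ≡ a
    first a b = trans (cong₂ _+ₙ_ (ℤₙ.*-identityʳ a) (ℤₙ.zeroʳ b)) (ℤₙ.+-identityʳ a)
    second : ∀ a b → (a *ₙ 0ₙ) +ₙ (b *ₙ 1ₙ) ≡ b
    second a b = trans (cong₂ _+ₙ_ (ℤₙ.zeroʳ a) (ℤₙ.*-identityʳ b)) (ℤₙ.+-identityˡ b)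

  SL-I : IsSL I₂
  SL-I = trans (ℤₙ.*-identityˡ 1ₙ) (sym (trans (cong (1ₙ +ₙ_) (ℤₙ.zeroˡ 0ₙ)) (ℤₙ.+-identityʳ 1ₙ)))

  invM : M2 → M2
  invM (m2 a b c d) = m2 d (-ₙ b) (-ₙ c) a

  SL-inv : ∀ γ → IsSL γ → IsSL (invM γ)
  SL-inv (m2 a b c d) det≡1 = trans (ℤₙ.*-comm d a) (trans det≡1 (cong (1ₙ +ₙ_) (neg-neg b c)))
    where
    open ℤ/n-Solver
    neg-neg : ∀ b c → b *ₙ c ≡ (-ₙ b) *ₙ (-ₙ c)
    neg-neg = solve 2 (λ b c → b :* c := (:- b) :* (:- c)) ≡.refl

  ·₂-inverseʳ : ∀ γ → IsSL γ → γ ·₂ invM γ ≡ I₂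
  ·₂-inverseʳ (m2 a b c d) det≡1 =
    m2-cong (trans (cong (_+ₙ (b *ₙ (-ₙ c))) det≡1) (cancel 1ₙ b c)) (vanish a b) (vanish' c d)
            (trans (swap a b c d) (trans (cong (_+ₙ (-ₙ (b *ₙ c))) det≡1) (cancel' 1ₙ b c)))
    where
    open ℤ/n-Solver
    cancel : ∀ o b c → (o +ₙ (b *ₙ c)) +ₙ (b *ₙ (-ₙ c)) ≡ o
    cancel = solve 3 (λ o b c → (o :+ (b :* c)) :+ (b :* (:- c)) := o) ≡.refl
    cancel' : ∀ o b c → (o +ₙ (b *ₙ c)) +ₙ (-ₙ (b *ₙ c)) ≡ o
    cancel' = solve 3 (λ o b c → (o :+ (b :* c)) :+ (:- (b :* c)) := o) ≡.refl
    vanish : ∀ a b → (a *ₙ (-ₙ b)) +ₙ (b *ₙ a) ≡ 0ₙ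
    vanish = solve 2 (λ a b → (a :* (:- b)) :+ (b :* a) := 0ℤ) ≡.refl
    vanish' : ∀ c d → (c *ₙ d) +ₙ (d *ₙ (-ₙ c)) ≡ 0ₙ
    vanish' = solve 2 (λ c d → (c :* d) :+ (d :* (:- c)) := 0ℤ) ≡.refl
    swap : ∀ a b c d → (c *ₙ (-ₙ b)) +ₙ (d *ₙ a) ≡ (a *ₙ d) +ₙ (-ₙ (b *ₙ c))
    swap = solve 4 (λ a b c d → (c :* (:- b)) :+ (d :* a) := (a :* d) :+ (:- (b :* c))) ≡.refl

  invM-involutive : ∀ γ → invM (invM γ) ≡ γ
  invM-involutive (m2 a b c d) = m2-cong ≡.refl (neg-neg b) (neg-neg c) ≡.refl
    where
    open ℤ/n-Solver
    neg-neg : ∀ b → -ₙ (-ₙ b) ≡ b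
    neg-neg = solve 1 (λ b → :- (:- b) := b) ≡.refl

  ·₂-inverseˡ : ∀ γ → IsSL γ → invM γ ·₂ γ ≡ I₂
  ·₂-inverseˡ γ det≡1 = trans (cong (invM γ ·₂_) (sym (invM-involutive γ)))
                              (·₂-inverseʳ (invM γ) (SL-inv γ det≡1))

module ThreeSets {c ℓ} (K : CommutativeRing c ℓ) (isField : IsField K) (e : ℕ)
                 (ζn : CommutativeRing.Carrier K) (prim : PrimitiveRoot K (suc (suc e ℕ.+ suc e)) ζn) where
  open CommutativeRing K hiding (zero)
  open Schrodinger K isField (suc e) ζn prim
  open Setup K n ζn
  open GroupIdentities (e ℕ.+ suc e)
  open M-Reasoning
  open ≡ using (cong; cong₂)

  θ-unit⊗ : ∀ A → (θ eH ⊗ A) ≈M A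
  θ-unit⊗ A = M.trans (⊗-congʳ A θ-unit) (⊗-identityˡ A)

  -- ρ(1) = 1 for every lift ρ: ρ(1) is idempotent, has determinant 1 and
  -- commutes with θ(σ) and θ(τ) because s_β(1) fixes σ and τ.
  lift-unit : (ρ : LiftII) → LiftII.fun ρ I₂ ≈M idM
  lift-unit ρ = idempotent-commutant-identity ρ₁ commutes-σ commutes-τ idempotent (detl I₂ SL-I)
    where
    open LiftII ρ
    ρ₁ = fun I₂
    commutes-σ : (ρ₁ ⊗ θ σH) ≈M (θ σH ⊗ ρ₁)
    commutes-σ = ≡.subst (λ h → (ρ₁ ⊗ θ σH) ≈M (θ h ⊗ ρ₁)) sβ-I-σ (lift I₂ SL-I σH)
    commutes-τ : (ρ₁ ⊗ θ τH) ≈M (θ τH ⊗ ρ₁)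
    commutes-τ = ≡.subst (λ h → (ρ₁ ⊗ θ τH) ≈M (θ h ⊗ ρ₁)) sβ-I-τ (lift I₂ SL-I τH)
    idempotent : (ρ₁ ⊗ ρ₁) ≈M ρ₁
    idempotent = M.sym (≡.subst (λ γ → fun γ ≈M (ρ₁ ⊗ ρ₁)) (·₂-identityʳ I₂) (hom I₂ I₂ SL-I SL-I))

  toII : SecI → LiftII
  toII s = record
    { fun = SecI.fun s
    ; detl = λ γ sl → proj₁ (SecI.inN s γ sl)
    ; hom = SecI.hom s
    ; lift = SecI.compat s }

  -- (ii) → (iii): θ⁺(h, γ) = θ(h) ρ(γ).  It is multiplicative because ρ(γ)
  -- conjugates θ(h') into θ(s_β(γ) h'), and extends θ because ρ(1) = 1.
  toIII : LiftII → ExtIII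
  toIII ρ = record
    { fun = λ p → θ (proj₁ p) ⊗ fun (proj₂ p)
    ; detl = λ h γ sl → trans (det-θ⊗ h (fun γ)) (detl γ sl)
    ; hom = multiplicative
    ; ext = λ h → M.trans (⊗-congˡ (θ h) (lift-unit ρ)) (⊗-identityʳ (θ h)) }
    where
    open LiftII ρ
    multiplicative : ∀ h γ h' γ' → IsSL γ → IsSL γ' →
                     (θ (h ·H sβ γ h') ⊗ fun (γ ·₂ γ')) ≈M ((θ h ⊗ fun γ) ⊗ (θ h' ⊗ fun γ'))
    multiplicative h γ h' γ' sl sl' = begin
      θ (h ·H sβ γ h') ⊗ fun (γ ·₂ γ')            ≈⟨ ⊗-cong (θ-hom h (sβ γ h')) (hom γ γ' sl sl') ⟩
      (θ h ⊗ θ (sβ γ h')) ⊗ (fun γ ⊗ fun γ')      ≈⟨ ⊗-assoc (θ h) (θ (sβ γ h')) (fun γ ⊗ fun γ') ⟩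
      θ h ⊗ (θ (sβ γ h') ⊗ (fun γ ⊗ fun γ'))      ≈⟨ ⊗-congˡ (θ h) (M.sym (⊗-assoc (θ (sβ γ h')) (fun γ) (fun γ'))) ⟩
      θ h ⊗ ((θ (sβ γ h') ⊗ fun γ) ⊗ fun γ')      ≈⟨ ⊗-congˡ (θ h) (⊗-congʳ (fun γ') (M.sym (lift γ sl h'))) ⟩
      θ h ⊗ ((fun γ ⊗ θ h') ⊗ fun γ')             ≈⟨ ⊗-congˡ (θ h) (⊗-assoc (fun γ) (θ h') (fun γ')) ⟩
      θ h ⊗ (fun γ ⊗ (θ h' ⊗ fun γ'))             ≈⟨ M.sym (⊗-assoc (θ h) (fun γ) (θ h' ⊗ fun γ')) ⟩
      (θ h ⊗ fun γ) ⊗ (θ h' ⊗ fun γ') ∎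

  module FromExtension (t : ExtIII) where
    open ExtIII t

    s : M2 → Mat n
    s γ = fun (eH , γ)

    -- θ⁺(h, γ) = θ(h) s(γ), since (h, γ) = (h, 1)(1, γ) in H_n⁺.
    factorisation : ∀ h γ → IsSL γ → (θ h ⊗ s γ) ≈M fun (h , γ)
    factorisation h γ sl = begin
      θ h ⊗ s γ                    ≈⟨ ⊗-congʳ (s γ) (M.sym (ext h)) ⟩
      fun (h , I₂) ⊗ fun (eH , γ)  ≈⟨ M.sym (hom h I₂ eH γ SL-I sl) ⟩
      fun ((h , I₂) ·H⁺ (eH , γ))  ≡⟨ cong₂ (λ u v → fun (u , v))
                                           (≡.trans (cong (h ·H_) (sβ-unit I₂)) (·H-identityʳ h)) (·₂-identityˡ γ) ⟩
      fun (h , γ) ∎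

    -- s is compatible with s_β, since (1, γ)(h, 1) = (s_β(γ) h, γ).
    compatible : ∀ γ → IsSL γ → ∀ h → (s γ ⊗ θ h) ≈M (θ (sβ γ h) ⊗ s γ)
    compatible γ sl h = begin
      s γ ⊗ θ h                    ≈⟨ ⊗-congˡ (s γ) (M.sym (ext h)) ⟩
      fun (eH , γ) ⊗ fun (h , I₂)  ≈⟨ M.sym (hom eH γ h I₂ sl SL-I) ⟩
      fun ((eH , γ) ·H⁺ (h , I₂))  ≡⟨ cong₂ (λ u v → fun (u , v)) (·H-identityˡ (sβ γ h)) (·₂-identityʳ γ) ⟩
      fun (sβ γ h , γ)             ≈⟨ M.sym (factorisation (sβ γ h) γ sl) ⟩
      θ (sβ γ h) ⊗ s γ ∎

    multiplicative : ∀ γ γ' → IsSL γ → IsSL γ' → s (γ ·₂ γ') ≈M (s γ ⊗ s γ')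
    multiplicative γ γ' sl sl' =
      ≡.subst (λ u → fun (u , γ ·₂ γ') ≈M (s γ ⊗ s γ'))
              (≡.trans (cong (eH ·H_) (sβ-unit γ)) (·H-identityˡ eH)) (hom eH γ eH γ' sl sl')

    unit : s I₂ ≈M idM
    unit = M.trans (ext eH) θ-unit

    inverseʳ : ∀ γ → IsSL γ → (s γ ⊗ s (invM γ)) ≈M idM
    inverseʳ γ sl = M.trans (M.sym (multiplicative γ (invM γ) sl (SL-inv γ sl)))
                            (≡.subst (λ u → s u ≈M idM) (≡.sym (·₂-inverseʳ γ sl)) unit)

    inverseˡ : ∀ γ → IsSL γ → (s (invM γ) ⊗ s γ) ≈M idM
    inverseˡ γ sl = M.trans (M.sym (multiplicative (invM γ) γ (SL-inv γ sl) sl))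
                            (≡.subst (λ u → s u ≈M idM) (≡.sym (·₂-inverseˡ γ sl)) unit)

    -- Every θ(h') is reached by conjugating some θ(h) with s(γ), namely
    -- h = s_β(γ⁻¹) h'; so s(γ) normalises θ(H_n).
    normalises : ∀ γ → IsSL γ → ∀ h' → (s γ ⊗ θ (sβ (invM γ) h')) ≈M (θ h' ⊗ s γ)
    normalises γ sl h' = begin
      G ⊗ X                    ≈⟨ M.sym (⊗-identityʳ (G ⊗ X)) ⟩
      (G ⊗ X) ⊗ idM            ≈⟨ ⊗-congˡ (G ⊗ X) (M.sym (inverseˡ γ sl)) ⟩
      (G ⊗ X) ⊗ (G⁻¹ ⊗ G)      ≈⟨ ⊗-assoc G X (G⁻¹ ⊗ G) ⟩
      G ⊗ (X ⊗ (G⁻¹ ⊗ G))      ≈⟨ ⊗-congˡ G (M.sym (⊗-assoc X G⁻¹ G)) ⟩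
      G ⊗ ((X ⊗ G⁻¹) ⊗ G)      ≈⟨ ⊗-congˡ G (⊗-congʳ G (M.sym (compatible (invM γ) (SL-inv γ sl) h'))) ⟩
      G ⊗ ((G⁻¹ ⊗ θ h') ⊗ G)   ≈⟨ ⊗-congˡ G (⊗-assoc G⁻¹ (θ h') G) ⟩
      G ⊗ (G⁻¹ ⊗ (θ h' ⊗ G))   ≈⟨ M.sym (⊗-assoc G G⁻¹ (θ h' ⊗ G)) ⟩
      (G ⊗ G⁻¹) ⊗ (θ h' ⊗ G)   ≈⟨ ⊗-congʳ (θ h' ⊗ G) (inverseʳ γ sl) ⟩
      idM ⊗ (θ h' ⊗ G)         ≈⟨ ⊗-identityˡ (θ h' ⊗ G) ⟩
      θ h' ⊗ G ∎
      where
      G = s γ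
      G⁻¹ = s (invM γ)
      X = θ (sβ (invM γ) h')

    section : ∀ γ → IsSL γ → AlphaIs (s γ) γ
    section (m2 a b c d) sl =
      (-ₙ ((a *ₙ c) *ₙ half) , ≡.subst (λ u → (s γ ⊗ θ σH) ≈M (θ u ⊗ s γ)) (sβ-σ a b c d) (compatible γ sl σH)) ,
      (-ₙ ((b *ₙ d) *ₙ half) , ≡.subst (λ u → (s γ ⊗ θ τH) ≈M (θ u ⊗ s γ)) (sβ-τ a b c d) (compatible γ sl τH))
      where γ = m2 a b c d

  toI : ExtIII → SecI
  toI t = record
    { fun = s
    ; inN = λ γ sl → ExtIII.detl t eH γ sl
                   , (λ h → sβ γ h , compatible γ sl h)
                   , (λ h' → sβ (invM γ) h' , normalises γ sl h')
    ; hom = multiplicative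
    ; sect = section
    ; compat = compatible }
    where open FromExtension t

  correspondence : Correspondence
  correspondence = record
    { toII = toII
    ; toII-def = λ s γ sl → M.refl
    ; toIII = toIII
    ; toIII-def = λ ρ h γ sl → M.refl
    ; toI = toI
    ; toI-def = λ t γ sl → M.refl
    ; cycleI = λ s γ sl → θ-unit⊗ (SecI.fun s γ)
    ; cycleII = λ ρ γ sl → θ-unit⊗ (LiftII.fun ρ γ)
    ; cycleIII = λ t → FromExtension.factorisation t }

odd-form : ∀ n → 3 ≤ n → n % 2 ≡ 1 → ∃ λ e → n ≡ suc (suc e ℕ.+ suc e)
odd-form n 3≤n odd with n ℕ./ 2 | Data.Nat.DivMod.m≡m%n+[m/n]*n n 2
... | zero | n≡ = ⊥-elim (3≰1 (≡.subst (3 ≤_) (≡.trans n≡ (≡.cong (ℕ._+ 0) odd)) 3≤n))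
  where
  3≰1 : ¬ (3 ≤ 1)
  3≰1 (s≤s ())
... | suc e | n≡ = e , ≡.trans n≡ (≡.trans (≡.cong (ℕ._+ suc e ℕ.* 2) odd) (double e))
  where
  open +-*-Solver
  double : ∀ e → 1 ℕ.+ suc e ℕ.* 2 ≡ suc (suc e ℕ.+ suc e)
  double = solve 1 (λ e → con 1 :+ (con 1 :+ e) :* con 2 := con 1 :+ ((con 1 :+ e) :+ (con 1 :+ e))) ≡.refl

-- Lemma 3.5.
lemma3p5 : ∀ {c ℓ} (K : CommutativeRing c ℓ) → IsField K → AlgClosed K →
           (n : ℕ) {{_ : NonZero n}} → 5 ≤ n → n % 2 ≡ 1 → CharNotDividing K n →
           (ζn : CommutativeRing.Carrier K) → PrimitiveRoot K n ζn →
           Setup.Correspondence K n ζn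
lemma3p5 K isField _ n 5≤n odd _ ζn prim with odd-form n (NP.≤-trans (s≤s (s≤s (s≤s z≤n))) 5≤n) odd
... | e , ≡.refl = ThreeSets.correspondence K isField e ζn prim
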